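{- For every $P\in\mathbb{K}[x_i\mid i\in\mathbb{N}]_+$, $$\Delta_{\mathbf{NMI}}(P)=P\otimes1+1\otimes P+\sum_{k=1}^\infty\frac1{k!}\big(D'^k\otimes|^{(k-1)}\big)\circ\tilde\Delta_{\mathrm{sh}}^{(k)}(P).$$ Moreover $\Delta_{\mathbf{NMI}}$ is homogeneous of degree $0$ for the length and for the degree.
   Context: $\mathbb{K}$ is a field of characteristic $0$. Let $\mathfrak{g}=\mathbb{K}[X_i\mid i\in\mathbb{N}]_+$ (non-unitary polynomials) with the pre-Lie product $P\blacktriangleleft Q=D(P)Q$, $D=\sum_n X_{n+1}\partial/\partial X_n$. Denote by $|$ the product of symmetric algebras. The Guin–Oudom extension to $S(\mathfrak{g})\otimes S(\mathfrak{g})\to S(\mathfrak{g})$ is: $x\blacktriangleleft1=x$, $x\blacktriangleleft(y_1|\cdots|y_n)=(x\blacktriangleleft(y_1|\cdots|y_{n-1}))\blacktriangleleft y_n-\sum_{i<n}x\blacktriangleleft(y_1|\cdots|y_i\blacktriangleleft y_n|\cdots|y_{n-1})$ for $x,y_j\in\mathfrak{g}$; $1\blacktriangleleft w=\varepsilon(w)$ and $(u|v)\blacktriangleleft w=\sum(u\blacktriangleleft w^{(1)})|(v\blacktriangleleft w^{(2)})$, with $\Delta_{\mathrm{sh}}(w)=\sum w^{(1)}\otimes w^{(2)}$ the coproduct of $S(\mathfrak{g})$ making elements of $\mathfrak{g}$ primitive and $\varepsilon$ its counit. The Grossman–Larson product is $u*v=\sum v^{(1)}|(u\blacktriangleleft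 v^{(2)})$. Let $(x_i)_{i\in\mathbb{N}}$ be commuting indeterminates; pair $\mathbb{K}[x_i]_+$ with $\mathfrak{g}$ by $\langle x^\alpha,X^\beta\rangle=\alpha!\,\delta_{\alpha,\beta}$ (where $x^\alpha=\prod x_i^{\alpha_i}$, $\alpha!=\prod\alpha_i!$), extended to a Hopf pairing between $S(\mathbb{K}[x_i]_+)$ and $S(\mathfrak{g})$: $\langle P_1|\cdots|P_k,Q_1|\cdots|Q_l\rangle=\delta_{k,l}\sum_{\sigma\in\mathfrak{S}_k}\prod_i\langle P_i,Q_{\sigma(i)}\rangle$. $\Delta_{\mathbf{NMI}}$ is the coproduct on $S(\mathbb{K}[x_i]_+)$ dual to $*$: $\langle\Delta_{\mathbf{NMI}}(A),U\otimes V\rangle=\langle A,U*V\rangle$. $D'$ is the derivation of $\mathbb{K}[x_i]_+$ with $D'(x_0)=0$, $D'(x_i)=x_{i-1}$ ($i\geq1$). $\tilde\Delta_{\mathrm{sh}}(P)=\Delta_{\mathrm{sh}}(P)-P\otimes1-1\otimes P$ for the usual coproduct of $\mathbb{K}[x_i]$ with $x_i$ primitive, $\tilde\Delta_{\mathrm{sh}}^{(k)}$ its $k$-th iterate, and $|^{(k-1)}(A_1\otimes\cdots\otimes A_k)=A_1|\cdots|A_k$. For a monomial $x^\alpha$: length $\ell=\sum\alpha_i$, weight $\omega=\sum i\alpha_i$, degree $\omega-\ell+1$; length and degree are extended additively to $|$-products and tensor products. -}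

module Defs where

open import Level using (_⊔_) renaming (suc to lsuc)
open import Algebra.Bundles using (CommutativeRing)
open import Data.Nat as ℕ using (ℕ; zero; suc)
open import Data.Integer as ℤ using (ℤ)
open import Data.Bool using (Bool; true; false; if_then_else_; _∧_)
open import Data.Maybe using (Maybe; just; nothing)
open import Data.Product using (_×_; _,_)
open import Data.List as List using (List; []; _∷_; _++_; concatMap; map; null)
open import Data.List.NonEmpty as List⁺ using (List⁺; _∷_; _⁺++⁺_; toList; fromList)
open import Relation.Nullary using (¬_)
open import Data.Nat.ListAction using () renaming (sum to sumℕ)

ringFromℕ : ∀ {c ℓ} (R : CommutativeRing c ℓ) → ℕ → CommutativeRing.Carrier R
ringFromℕ R zero    = CommutativeRing.0# R
ringFromℕ R (suc n) = CommutativeRing._+_ R (CommutativeRing.1# R) (ringFromℕ R n)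

record CharZeroField c ℓ : Set (lsuc (c ⊔ ℓ)) where
  field
    commutativeRing : CommutativeRing c ℓ
  open CommutativeRing commutativeRing public
  fromℕ : ℕ → Carrier
  fromℕ = ringFromℕ commutativeRing
  field
    0≉1     : ¬ (0# ≈ 1#)
    _⁻¹     : (x : Carrier) → ¬ (x ≈ 0#) → Carrier
    inverse : (x : Carrier) (nz : ¬ (x ≈ 0#)) → x * (x ⁻¹) nz ≈ 1#
    char0   : (n : ℕ) → ¬ (fromℕ (suc n) ≈ 0#)

-- A monomial (of K[x_i]_+ or of g = K[X_i]_+) is a NONEMPTY multiset of
-- variable indices, represented by a nonempty list (with repetitions):
-- i₁ ∷ … ∷ iₗ  stands for  x_{i₁}⋯x_{iₗ}  (resp. X_{i₁}⋯X_{iₗ}).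
Mono : Set
Mono = List⁺ ℕ

-- A basis word of the symmetric algebra S(V): m₁ | ⋯ | mₖ  (k ≥ 0, [] = 1).
Word : Set
Word = List Mono

remove1 : ℕ → List ℕ → Maybe (List ℕ)
remove1 i []       = nothing
remove1 i (j ∷ js) with i ℕ.≡ᵇ j
... | true  = just js
... | false with remove1 i js
...   | nothing  = nothing
...   | just js' = just (j ∷ js')

sameMS : List ℕ → List ℕ → Bool
sameMS []       []       = true
sameMS []       (_ ∷ _)  = false
sameMS (i ∷ is) js with remove1 i js
... | nothing  = false
... | just js' = sameMS is js'

count : ℕ → List ℕ → ℕ
count i []       = 0
count i (j ∷ js) = if i ℕ.≡ᵇ j then suc (count i js) else count i js

-- α! = ∏ᵢ αᵢ!  for the multiset α
mfact : List ℕ → ℕ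
mfact []       = 1
mfact (i ∷ is) = suc (count i is) ℕ.* mfact is

splits : {A : Set} → List A → List (List A × List A)
splits []       = ([] , []) ∷ []
splits (y ∷ ys) = concatMap (λ { (a , b) → (y ∷ a , b) ∷ (a , y ∷ b) ∷ [] }) (splits ys)

picks : {A : Set} → List A → List (A × List A)
picks []       = []
picks (y ∷ ys) = (y , ys) ∷ map (λ { (a , r) → (a , y ∷ r) }) (picks ys)

replacements : {A : Set} → List A → List (A × (A → List A))
replacements []       = []
replacements (y ∷ ys) =
  (y , (λ z → z ∷ ys)) ∷ map (λ { (a , f) → (a , (λ z → y ∷ f z)) }) (replacements ys)

-- D on a monomial of g: sum over occurrences, index n ↦ n+1 (list of resulting monomials)
incAllL : List ℕ → List (List ℕ)
incAllL []       = []
incAllL (x ∷ xs) = (suc x ∷ xs) ∷ map (x ∷_) (incAllL xs)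

incAll : Mono → List Mono
incAll (x ∷ xs) = (suc x ∷ xs) ∷ map (x ∷_) (incAllL xs)

-- D' on a monomial of K[x]: sum over occurrences, x₀ ↦ 0, xᵢ ↦ x_{i-1}
decAllL : List ℕ → List (List ℕ)
decAllL []            = []
decAllL (zero  ∷ xs)  = map (zero ∷_) (decAllL xs)
decAllL (suc x ∷ xs)  = (x ∷ xs) ∷ map (suc x ∷_) (decAllL xs)

decAll : Mono → List Mono
decAll (zero  ∷ xs) = map (zero ∷_) (decAllL xs)
decAll (suc x ∷ xs) = (x ∷ xs) ∷ map (suc x ∷_) (decAllL xs)

-- reduced coproduct Δ̃_sh on a monomial: splittings into two nonempty parts
properSplits : Mono → List (Mono × Mono)
properSplits m = concatMap keep (splits (toList m))
  where
  keep : List ℕ × List ℕ → List (Mono × Mono)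
  keep (a , b) with fromList a | fromList b
  ... | just a' | just b' = (a' , b') ∷ []
  ... | _       | _       = []

-- k-th iterate Δ̃_sh^{(k)} on a monomial: list of its (k+1)-fold tensors
-- P₀ ⊗ P₁ ⊗ ⋯ ⊗ P_k (all coefficients are 1), defined by
-- Δ̃^{(0)} = id , Δ̃^{(k+1)} = (id ⊗ Δ̃^{(k)}) ∘ Δ̃   (coassociativity).
redIter : ℕ → Mono → List (List⁺ Mono)
redIter zero    m = (m ∷ []) ∷ []
redIter (suc k) m =
  concatMap (λ { (a , b) → map (λ t → a ∷ toList t) (redIter k b) }) (properSplits m)

lenM : Mono → ℕ
lenM = List⁺.length

lenW : Word → ℕ
lenW w = sumℕ (map lenM w)

degM : Mono → ℤ
degM m = (ℤ.+ sumℕ (toList m)) ℤ.- (ℤ.+ lenM m) ℤ.+ ℤ.+ 1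

degW : Word → ℤ
degW w = List.foldr ℤ._+_ (ℤ.+ 0) (map degM w)

-- Field-dependent constructions.  Elements of the various vector spaces
-- are represented as formal (finite) linear combinations of basis elements.

module WithField {c ℓ} (F : CharZeroField c ℓ) where
  open CharZeroField F

  Lin : Set → Set c
  Lin B = List (Carrier × B)

  scale : {B : Set} → Carrier → Lin B → Lin B
  scale a = map (λ { (b , x) → (a * b , x) })

  neg : {B : Set} → Lin B → Lin B
  neg = map (λ { (b , x) → (- b , x) })

  bind : {A B : Set} → Lin A → (A → Lin B) → Lin B
  bind v f = concatMap (λ { (a , x) → scale a (f x) }) v

  -- elements of g = K[X_i]_+ and of K[x_i]_+
  Poly : Set c
  Poly = Lin Mono

  -- elements of S(g), S(K[x]_+), and of S ⊗ S
  SElem : Set c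
  SElem = Lin Word

  STensor : Set c
  STensor = Lin (Word × Word)

  bar : SElem → SElem → SElem
  bar u v = bind u (λ a → map (λ { (d , b) → (d , a ++ b) }) v)

  -- pre-Lie product on g:  M ◀ y = D(M) y
  preLie : Mono → Mono → Poly
  preLie M y = map (λ M' → (1# , M' ⁺++⁺ y)) (incAll M)

  preLieP : Poly → Mono → Poly
  preLieP p y = bind p (λ M → preLie M y)

  -- Guin–Oudom: x ◀ (y₁|⋯|yₙ), computed on the REVERSED word (head = yₙ),
  -- with a fuel argument (the function is called with fuel = word length).
  goR : ℕ → Mono → List Mono → Poly
  goR _       x []       = (1# , x) ∷ []
  goR zero    x (_ ∷ _)  = []
  goR (suc n) x (y ∷ rs) =
    preLieP (goR n x rs) y
    ++ neg (concatMap (λ { (yi , put) → bind (preLie yi y) (λ m → goR n x (put m)) })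
                      (replacements rs))

  actMono : Mono → Word → Poly
  actMono x w = goR (List.length w) x (List.reverse w)

  -- u ◀ w  for words u, w :  1 ◀ w = ε(w),
  -- (u|v) ◀ w = Σ (u ◀ w⁽¹⁾) | (v ◀ w⁽²⁾)  with Δ_sh(w) = Σ over splittings
  act : Word → Word → SElem
  act []       w = if null w then (1# , []) ∷ [] else []
  act (u ∷ us) w =
    concatMap (λ { (s , t) →
      bar (map (λ { (a , m) → (a , m ∷ []) }) (actMono u s)) (act us t) })
      (splits w)

  -- Grossman–Larson product  u * v = Σ v⁽¹⁾ | (u ◀ v⁽²⁾)
  gl : Word → Word → SElem
  gl u v = concatMap (λ { (s , t) → map (λ { (a , w) → (a , s ++ w) }) (act u t) })
                     (splits v)

  glS : SElem → SElem → SElem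
  glS u v = bind u (λ a → bind v (λ b → gl a b))

  pairMono : Mono → Mono → Carrier
  pairMono a b = if sameMS (toList a) (toList b) then fromℕ (mfact (toList a)) else 0#

  -- ⟨P₁|⋯|P_k , Q₁|⋯|Q_l⟩ = δ_{k,l} Σ_σ ∏ ⟨P_i , Q_σ(i)⟩   (permanent)
  pairW : Word → Word → Carrier
  pairW []       []      = 1#
  pairW []       (_ ∷ _) = 0#
  pairW (p ∷ ps) qs      =
    List.foldr _+_ 0# (map (λ { (q , rest) → pairMono p q * pairW ps rest }) (picks qs))

  sumK : List Carrier → Carrier
  sumK = List.foldr _+_ 0#

  pairS : SElem → SElem → Carrier
  pairS A U = sumK (concatMap (λ { (a , w) → map (λ { (b , u) → a * b * pairW w u }) U }) A)

  pairT : STensor → Word → Word → Carrier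
  pairT T U V = sumK (map (λ { (a , (w₁ , w₂)) → a * pairW w₁ U * pairW w₂ V }) T)

  -- Δ_NMI(A), represented by its values ⟨Δ_NMI(A) , U ⊗ V⟩ = ⟨A , U * V⟩ on
  -- the basis words U, V of S(g) (this is the definition of Δ_NMI as the
  -- coproduct dual to *; the pairing is nondegenerate).
  ΔNMI : SElem → Word → Word → Carrier
  ΔNMI A U V = pairS A (gl U V)

  embed : Poly → SElem
  embed = map (λ { (a , m) → (a , m ∷ []) })

  invFact : ℕ → Carrier
  invFact zero    = 1#
  invFact (suc k) = invFact k * (fromℕ (suc k) ⁻¹) (char0 k)

  D' : Poly → Poly
  D' p = bind p (λ m → map (λ m' → (1# , m')) (decAll m))

  D'^ : ℕ → Poly → Poly
  D'^ zero    p = p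
  D'^ (suc k) p = D' (D'^ k p)

  -- the k-th summand (1/k!) (D'^k ⊗ |^{(k-1)}) ∘ Δ̃_sh^{(k)} (P)
  term : ℕ → Poly → STensor
  term k P = bind P (λ m →
    concatMap (λ { (p₀ ∷ rest) →
      map (λ { (e , m') → (invFact k * e , (m' ∷ [] , rest)) }) (D'^ k ((1# , p₀) ∷ [])) })
      (redIter k m))

  -- Σ_{k=1}^{N} ; for N ≥ the maximal length of a monomial of P all further
  -- summands are empty (Δ̃^{(k)} vanishes), so this is the full series.
  sumTerms : ℕ → Poly → STensor
  sumTerms zero    P = []
  sumTerms (suc N) P = sumTerms N P ++ term (suc N) P

  bound : Poly → ℕ
  bound P = sumℕ (map (λ { (_ , m) → lenM m }) P)

  rhs : Poly → STensor
  rhs P = map (λ { (a , m) → (a , (m ∷ [] , [])) }) P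
       ++ map (λ { (a , m) → (a , ([] , m ∷ []))  }) P
       ++ sumTerms (bound P) P

-- Everything is tested against basis words U ⊗ V of S(g) ⊗ S(g). The pairing ⟨xᵅ, Xᵝ⟩ = α! δ_{α,β}
-- counts index-preserving bijections; it is a Hopf pairing (products of monomials against the
-- deshuffle coproduct) for which D′ is the adjoint of D. On g the Guin–Oudom extension is
-- x ◀ (y₁ | ⋯ | yₙ) = Dⁿ(x) y₁ ⋯ yₙ: in the recursion, the correction terms cancel exactly the
-- Leibniz terms in which D hits one of the yᵢ. Hence, for a monomial m, ⟨m, U * V⟩ vanishes unless
-- U = 1, giving ⟨m, V⟩, or U = u, giving ⟨m, Dᵏ(u) v₁ ⋯ vₖ⟩ with k = |V|. Splitting m along the
-- coproduct turns the latter into Σ ⟨D′ᵏ m′, u⟩ ⟨m″, v₁ ⋯ vₖ⟩, and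
-- k! ⟨m″, v₁ ⋯ vₖ⟩ = ⟨Δ̃⁽ᵏ⁻¹⁾ m″, v₁ | ⋯ | vₖ⟩: this is the pairing of the k-th summand.
-- Homogeneity: a grading of monomials that is additive on D(M) Y (length and degree are) is additive
-- on the Grossman–Larson product, and the pairing vanishes between different grades.

module Submission where

open import Defs
open import Data.Nat using () renaming (_+_ to _+ℕ_)
open import Data.Integer using () renaming (_+_ to _+ℤ_)
open import Data.Product using (_×_; _,_)
open import Data.List using ([]; _∷_)
open import Relation.Binary.PropositionalEquality using (_≢_)

open import Level using (Level; _⊔_)
open import Algebra.Bundles using (AbelianGroup; CommutativeRing)
open import Data.Nat as ℕ using (ℕ; zero; suc; _≤_; _<_; _!)
import Data.Nat.Properties as ℕP
open import Data.Nat.ListAction using () renaming (sum to sumℕ)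
open import Data.Nat.ListAction.Properties using (sum-↭; sum-++)
open import Data.Integer as ℤ using (ℤ)
import Data.Integer.Properties as ℤP
open import Data.Integer.Tactic.RingSolver using (solve-∀)
open import Data.Bool using (true; false; if_then_else_; T)
open import Data.Maybe using (just; nothing)
open import Data.Product using (proj₁; proj₂; ∃)
open import Data.List as List using (List; _++_; map; concatMap; concat; length)
import Data.List.Properties as Listₚ
open import Data.List.NonEmpty as List⁺ using (List⁺; _∷_; _⁺++⁺_; toList)
open import Data.List.Membership.Propositional using (_∈_)
open import Data.List.Relation.Unary.Any using (here; there)
open import Data.List.Relation.Unary.All as All using (All; []; _∷_)
import Data.List.Relation.Unary.All.Properties as AllP
open import Data.List.Relation.Binary.Permutation.Propositional as Perm
  using (_↭_; ↭-refl; ↭-prep; ↭-swap; ↭-sym; ↭-trans; ↭-reflexive; ↭⇒↭ₛ)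
open import Data.List.Relation.Binary.Permutation.Propositional.Properties
  using (↭-length; ↭-empty-inv; ∈-resp-↭; drop-∷; shift; shifts; ↭-reverse; ++⁺ˡ; ++⁺ʳ; ++-comm)
  renaming (map⁺ to ↭-map⁺)
open import Data.List.Relation.Binary.Permutation.Setoid.Properties using (foldr-commMonoid)
open import Relation.Binary.PropositionalEquality as ≡ using (_≡_)
open import Relation.Nullary using (yes; no)

private variable
  a p : Level
  A B : Set a

-- Multisets of indices and list combinatorics

≡ᵇ-refl : ∀ i → (i ℕ.≡ᵇ i) ≡ true
≡ᵇ-refl zero    = ≡.refl
≡ᵇ-refl (suc i) = ≡ᵇ-refl i

≡ᵇ⇒≡ : ∀ i j → (i ℕ.≡ᵇ j) ≡ true → i ≡ j
≡ᵇ⇒≡ i j e = ℕP.≡ᵇ⇒≡ i j (≡.subst T (≡.sym e) _)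

concatMap⁺ : {P : B → Set p} {f : A → List B} {xs : List A} →
             All (λ x → All P (f x)) xs → All P (concatMap f xs)
concatMap⁺ h = AllP.concat⁺ (AllP.map⁺ h)

remove1-↭ : ∀ i js {js′} → remove1 i js ≡ just js′ → js ↭ i ∷ js′
remove1-↭ i [] ()
remove1-↭ i (j ∷ js) e with i ℕ.≡ᵇ j in i≡ᵇj
remove1-↭ i (j ∷ js) ≡.refl | true rewrite ≡ᵇ⇒≡ i j i≡ᵇj = ↭-refl
... | false with remove1 i js in removed
remove1-↭ i (j ∷ js) ≡.refl | false | just _ =
  ↭-trans (↭-prep j (remove1-↭ i js removed)) (↭-swap j i ↭-refl)

remove1-∈ : ∀ i js → i ∈ js → ∃ λ js′ → remove1 i js ≡ just js′
remove1-∈ i (j ∷ js) i∈ with i ℕ.≡ᵇ j in i≡ᵇj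
... | true = js , ≡.refl
remove1-∈ i (j ∷ js) (here ≡.refl) | false with () ← ≡.trans (≡.sym i≡ᵇj) (≡ᵇ-refl i)
remove1-∈ i (j ∷ js) (there i∈) | false with remove1 i js in removed
... | just js′ = j ∷ js′ , ≡.refl
... | nothing with () ← ≡.trans (≡.sym removed) (proj₂ (remove1-∈ i js i∈))

sameMS⇒↭ : ∀ is js → sameMS is js ≡ true → is ↭ js
sameMS⇒↭ [] [] _ = ↭-refl
sameMS⇒↭ (i ∷ is) js e with remove1 i js in removed
... | just js′ = ↭-trans (↭-prep i (sameMS⇒↭ is js′ e)) (↭-sym (remove1-↭ i js removed))

↭⇒sameMS : ∀ is js → is ↭ js → sameMS is js ≡ true
↭⇒sameMS [] js p rewrite ↭-empty-inv (↭-sym p) = ≡.refl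
↭⇒sameMS (i ∷ is) js p with remove1 i js in removed
... | just js′ = ↭⇒sameMS is js′ (drop-∷ (↭-trans p (remove1-↭ i js removed)))
... | nothing with () ← ≡.trans (≡.sym removed) (proj₂ (remove1-∈ i js (∈-resp-↭ p (here ≡.refl))))

count-↭ : ∀ i {is js} → is ↭ js → count i is ≡ count i js
count-↭ i Perm.refl = ≡.refl
count-↭ i (Perm.prep j p) rewrite count-↭ i p = ≡.refl
count-↭ i {j ∷ k ∷ _} (Perm.swap j k p) rewrite count-↭ i p with i ℕ.≡ᵇ j | i ℕ.≡ᵇ k
... | true  | true  = ≡.refl
... | true  | false = ≡.refl
... | false | true  = ≡.refl
... | false | false = ≡.refl
count-↭ i (Perm.trans p q) = ≡.trans (count-↭ i p) (count-↭ i q)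

splits-↭ : (xs : List A) → All (λ st → proj₁ st ++ proj₂ st ↭ xs) (splits xs)
splits-↭ [] = ↭-refl ∷ []
splits-↭ (y ∷ ys) = concatMap⁺ (All.map (λ {st} e →
  ↭-prep y e ∷ ↭-trans (shift y (proj₁ st) (proj₂ st)) (↭-prep y e) ∷ []) (splits-↭ ys))

splits-length : (xs : List A) →
  All (λ st → length (proj₁ st) ℕ.+ length (proj₂ st) ≡ length xs) (splits xs)
splits-length xs = All.map (λ {st} e → ≡.trans (≡.sym (Listₚ.length-++ (proj₁ st))) (↭-length e))
                           (splits-↭ xs)

picks-↭ : (xs : List A) → All (λ p → xs ↭ proj₁ p ∷ proj₂ p) (picks xs)
picks-↭ [] = []
picks-↭ (y ∷ ys) = ↭-refl ∷ AllP.gmap⁺ (λ {p} e → ↭-trans (↭-prep y e) (↭-swap y (proj₁ p) ↭-refl)) (picks-↭ ys)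

picks-length : (xs : List A) → All (λ p → suc (length (proj₂ p)) ≡ length xs) (picks xs)
picks-length xs = All.map (λ e → ≡.sym (↭-length e)) (picks-↭ xs)

length-picks : (xs : List A) → length (picks xs) ≡ length xs
length-picks [] = ≡.refl
length-picks (y ∷ ys) = ≡.cong suc (≡.trans (Listₚ.length-map _ (picks ys)) (length-picks ys))

lenM≡length : ∀ m → lenM m ≡ length (toList m)
lenM≡length (_ ∷ _) = ≡.refl

toList-⁺++⁺ : ∀ (m n : Mono) → toList (m ⁺++⁺ n) ≡ toList m ++ toList n
toList-⁺++⁺ (_ ∷ _) (_ ∷ _) = ≡.refl

flatten : Word → List ℕ
flatten []      = []
flatten (m ∷ w) = toList m ++ flatten w

flatten-↭ : ∀ {V W} → V ↭ W → flatten V ↭ flatten W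
flatten-↭ Perm.refl = ↭-refl
flatten-↭ (Perm.prep m p) = ++⁺ˡ (toList m) (flatten-↭ p)
flatten-↭ (Perm.swap m n p) =
  ↭-trans (shifts (toList m) (toList n)) (++⁺ˡ (toList n) (++⁺ˡ (toList m) (flatten-↭ p)))
flatten-↭ (Perm.trans p q) = ↭-trans (flatten-↭ p) (flatten-↭ q)

replacements-↭ : (xs : List A) →
  All (λ r → ∀ z → proj₁ r ∷ proj₂ r z ↭ z ∷ xs) (replacements xs)
replacements-↭ [] = []
replacements-↭ (y ∷ ys) = (λ z → ↭-swap y z ↭-refl) ∷ AllP.gmap⁺ (λ {r} h z →
  ↭-trans (↭-swap (proj₁ r) y ↭-refl) (↭-trans (↭-prep y (h z)) (↭-swap y z ↭-refl)))
  (replacements-↭ ys)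

-- The derivations D and D′ on index lists

incAllL-shape : ∀ xs →
  All (λ l → length l ≡ length xs × sumℕ l ≡ suc (sumℕ xs)) (incAllL xs)
incAllL-shape [] = []
incAllL-shape (x ∷ xs) = (≡.refl , ≡.refl) ∷ AllP.gmap⁺ (λ (len≡ , sum≡) →
  ≡.cong suc len≡ , ≡.trans (≡.cong (x ℕ.+_) sum≡) (ℕP.+-suc x _)) (incAllL-shape xs)

toList-incAll : ∀ M → map toList (incAll M) ≡ incAllL (toList M)
toList-incAll (x ∷ xs) = ≡.cong ((suc x ∷ xs) ∷_) (≡.sym (Listₚ.map-∘ (incAllL xs)))

toList-decAll : ∀ M → map toList (decAll M) ≡ decAllL (toList M)
toList-decAll (zero  ∷ xs) = ≡.sym (Listₚ.map-∘ (decAllL xs))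
toList-decAll (suc x ∷ xs) = ≡.cong ((x ∷ xs) ∷_) (≡.sym (Listₚ.map-∘ (decAllL xs)))

incAll-shape : ∀ M →
  All (λ M′ → lenM M′ ≡ lenM M × sumℕ (toList M′) ≡ suc (sumℕ (toList M))) (incAll M)
incAll-shape M =
  All.map (λ {M′} (len≡ , sum≡) → ≡.trans (lenM≡length M′) len≡ , sum≡)
    (AllP.map⁻ (≡.subst (All _) (≡.sym (toList-incAll M))
      (All.map (λ (len≡ , sum≡) → ≡.trans len≡ (≡.sym (lenM≡length M)) , sum≡)
        (incAllL-shape (toList M)))))

lenM-⁺++⁺ : ∀ m n → lenM (m ⁺++⁺ n) ≡ lenM m ℕ.+ lenM n
lenM-⁺++⁺ (_ ∷ xs) (_ ∷ _) = ≡.cong suc (Listₚ.length-++ xs)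

lenM-↭ : ∀ {m n} → toList m ↭ toList n → lenM m ≡ lenM n
lenM-↭ {m} {n} p = ≡.trans (lenM≡length m) (≡.trans (↭-length p) (≡.sym (lenM≡length n)))

lenM-preLie : ∀ M y → All (λ M′ → lenM (M′ ⁺++⁺ y) ≡ lenM M ℕ.+ lenM y) (incAll M)
lenM-preLie M y = All.map (λ {M′} (len≡ , _) →
  ≡.trans (lenM-⁺++⁺ M′ y) (≡.cong (ℕ._+ lenM y) len≡)) (incAll-shape M)

private
  deg : ℕ → ℕ → ℤ
  deg s l = ℤ.+ s ℤ.- ℤ.+ l ℤ.+ ℤ.+ 1

  deg-suc-+ : ∀ s l s′ l′ → deg (suc s ℕ.+ s′) (l ℕ.+ l′) ≡ deg s l ℤ.+ deg s′ l′
  deg-suc-+ s l s′ l′ rewrite ℤP.pos-+ (suc s) s′ | ℤP.pos-+ l l′ | ℤP.pos-+ 1 s =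
    identity (ℤ.+ s) (ℤ.+ l) (ℤ.+ s′) (ℤ.+ l′)
    where
    identity : ∀ s l s′ l′ → ((ℤ.+ 1 ℤ.+ s) ℤ.+ s′) ℤ.- (l ℤ.+ l′) ℤ.+ ℤ.+ 1
                           ≡ (s ℤ.- l ℤ.+ ℤ.+ 1) ℤ.+ (s′ ℤ.- l′ ℤ.+ ℤ.+ 1)
    identity = solve-∀

degM-↭ : ∀ {m n} → toList m ↭ toList n → degM m ≡ degM n
degM-↭ p = ≡.cong₂ deg (sum-↭ p) (lenM-↭ p)

degM-preLie : ∀ M y → All (λ M′ → degM (M′ ⁺++⁺ y) ≡ degM M ℤ.+ degM y) (incAll M)
degM-preLie M y = All.map (λ {M′} (len≡ , sum≡) → ≡.trans
  (≡.cong₂ deg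
    (≡.trans (≡.cong sumℕ (toList-⁺++⁺ M′ y))
      (≡.trans (sum-++ (toList M′) (toList y)) (≡.cong (ℕ._+ sumℕ (toList y)) sum≡)))
    (≡.trans (lenM-⁺++⁺ M′ y) (≡.cong (ℕ._+ lenM y) len≡)))
  (deg-suc-+ (sumℕ (toList M)) (lenM M) (sumℕ (toList y)) (lenM y)))
  (incAll-shape M)

incAllL^ : ℕ → List ℕ → List (List ℕ)
incAllL^ zero    xs = xs ∷ []
incAllL^ (suc k) xs = concatMap incAllL (incAllL^ k xs)

incAllL^-length : ∀ k xs → All (λ ys → length ys ≡ length xs) (incAllL^ k xs)
incAllL^-length zero    xs = ≡.refl ∷ []
incAllL^-length (suc k) xs = concatMap⁺ (All.map (λ {ys} ys≡ →
  All.map (λ e → ≡.trans (proj₁ e) ys≡) (incAllL-shape ys)) (incAllL^-length k xs))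

incAllL^′ : ℕ → List ℕ → List (List ℕ)
incAllL^′ zero    xs = xs ∷ []
incAllL^′ (suc k) xs = concatMap (incAllL^′ k) (incAllL xs)

properSplits-length : ∀ m → All (λ p → suc (lenM (proj₂ p)) ≤ lenM m) (properSplits m)
properSplits-length m = concatMap⁺ (All.map (λ {st} → bound st) (splits-length (toList m)))
  where
  bound : ∀ st → length (proj₁ st) ℕ.+ length (proj₂ st) ≡ length (toList m) →
          All (λ p → suc (lenM (proj₂ p)) ≤ lenM m) _
  bound ([]     , _)      _ = []
  bound (_ ∷ _  , [])     _ = []
  bound (_ ∷ xs , _ ∷ ys) e = ≡.subst (suc (suc (length ys)) ≤_) (≡.trans e (≡.sym (lenM≡length m)))
    (ℕ.s≤s (ℕP.m≤n+m (suc (length ys)) (length xs))) ∷ []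

redIter-tail-length : ∀ k m → All (λ t → length (List⁺.tail t) ≡ k) (redIter k m)
redIter-tail-length zero    m = ≡.refl ∷ []
redIter-tail-length (suc k) m = concatMap⁺ (All.universal (λ p →
  AllP.map⁺ (All.map (≡.cong suc) (redIter-tail-length k (proj₂ p)))) (properSplits m))

redIter-empty : ∀ k m → lenM m ≤ k → redIter k m ≡ []
redIter-empty zero    (_ ∷ _) ()
redIter-empty (suc k) m le = concatMap-[] (properSplits m) (All.map (λ {p} lt →
  ≡.cong (map _) (redIter-empty k (proj₂ p) (ℕP.≤-pred (ℕP.≤-trans lt le)))) (properSplits-length m))
  where
  concatMap-[] : (xs : List A) {f : A → List B} → All (λ x → f x ≡ []) xs → concatMap f xs ≡ []
  concatMap-[] []       []       = ≡.refl
  concatMap-[] (x ∷ xs) (e ∷ es) rewrite e = concatMap-[] xs es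

-- Finite sums in a commutative ring

module FiniteSums {c ℓ} (R : CommutativeRing c ℓ) where
  open CommutativeRing R
  open import Algebra.Properties.Ring ring using (-0#≈0#; -‿+-comm)
  open import Algebra.Properties.CommutativeSemigroup +-commutativeSemigroup using (interchange)

  Σ : List A → (A → Carrier) → Carrier
  Σ xs f = List.foldr _+_ 0# (map f xs)

  Σ-cong : (xs : List A) {f g : A → Carrier} → (∀ x → f x ≈ g x) → Σ xs f ≈ Σ xs g
  Σ-cong []       e = refl
  Σ-cong (x ∷ xs) e = +-cong (e x) (Σ-cong xs e)

  Σ-cong-All : (xs : List A) {f g : A → Carrier} → All (λ x → f x ≈ g x) xs → Σ xs f ≈ Σ xs g
  Σ-cong-All []       []       = refl
  Σ-cong-All (x ∷ xs) (e ∷ es) = +-cong e (Σ-cong-All xs es)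

  Σ-0 : (xs : List A) → Σ xs (λ _ → 0#) ≈ 0#
  Σ-0 []       = refl
  Σ-0 (x ∷ xs) = trans (+-identityˡ _) (Σ-0 xs)

  Σ-zero : (xs : List A) {f : A → Carrier} → (∀ x → f x ≈ 0#) → Σ xs f ≈ 0#
  Σ-zero xs e = trans (Σ-cong xs e) (Σ-0 xs)

  Σ-zero-All : (xs : List A) {f : A → Carrier} → All (λ x → f x ≈ 0#) xs → Σ xs f ≈ 0#
  Σ-zero-All xs es = trans (Σ-cong-All xs es) (Σ-0 xs)

  Σ-map : (xs : List A) (g : A → B) (f : B → Carrier) → Σ (map g xs) f ≈ Σ xs (λ x → f (g x))
  Σ-map xs g f = reflexive (≡.cong (List.foldr _+_ 0#) (≡.sym (Listₚ.map-∘ xs)))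

  Σ-++ : (xs ys : List A) (f : A → Carrier) → Σ (xs ++ ys) f ≈ Σ xs f + Σ ys f
  Σ-++ []       ys f = sym (+-identityˡ _)
  Σ-++ (x ∷ xs) ys f = trans (+-congˡ (Σ-++ xs ys f)) (sym (+-assoc _ _ _))

  Σ-concat : (xss : List (List A)) (f : A → Carrier) → Σ (concat xss) f ≈ Σ xss (λ xs → Σ xs f)
  Σ-concat []         f = refl
  Σ-concat (xs ∷ xss) f = trans (Σ-++ xs (concat xss) f) (+-congˡ (Σ-concat xss f))

  Σ-concatMap : (xs : List A) (g : A → List B) (f : B → Carrier) →
                Σ (concatMap g xs) f ≈ Σ xs (λ x → Σ (g x) f)
  Σ-concatMap xs g f = trans (Σ-concat (map g xs) f) (Σ-map xs g (λ ys → Σ ys f))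

  foldr-+-concatMap : (xs : List A) (g : A → List Carrier) →
    List.foldr _+_ 0# (concatMap g xs) ≈ Σ xs (λ x → List.foldr _+_ 0# (g x))
  foldr-+-concatMap xs g = trans (reflexive (≡.cong (List.foldr _+_ 0#) (≡.sym (Listₚ.map-id (concatMap g xs)))))
    (trans (Σ-concatMap xs g (λ a → a))
      (Σ-cong xs (λ x → reflexive (≡.cong (List.foldr _+_ 0#) (Listₚ.map-id (g x))))))

  Σ-+ : (xs : List A) (f g : A → Carrier) → Σ xs (λ x → f x + g x) ≈ Σ xs f + Σ xs g
  Σ-+ []       f g = sym (+-identityˡ _)
  Σ-+ (x ∷ xs) f g = trans (+-congˡ (Σ-+ xs f g)) (interchange _ _ _ _)

  Σ-*ˡ : (a : Carrier) (xs : List A) (f : A → Carrier) → a * Σ xs f ≈ Σ xs (λ x → a * f x)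
  Σ-*ˡ a []       f = zeroʳ a
  Σ-*ˡ a (x ∷ xs) f = trans (distribˡ a _ _) (+-congˡ (Σ-*ˡ a xs f))

  Σ-*ʳ : (a : Carrier) (xs : List A) (f : A → Carrier) → Σ xs f * a ≈ Σ xs (λ x → f x * a)
  Σ-*ʳ a xs f = trans (*-comm _ _) (trans (Σ-*ˡ a xs f) (Σ-cong xs (λ x → *-comm a (f x))))

  Σ-neg : (xs : List A) (f : A → Carrier) → - Σ xs f ≈ Σ xs (λ x → - f x)
  Σ-neg []       f = -0#≈0#
  Σ-neg (x ∷ xs) f = trans (sym (-‿+-comm _ _)) (+-congˡ (Σ-neg xs f))

  Σ-swap : (xs : List A) (ys : List B) (f : A → B → Carrier) →
           Σ xs (λ x → Σ ys (f x)) ≈ Σ ys (λ y → Σ xs (λ x → f x y))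
  Σ-swap []       ys f = sym (Σ-0 ys)
  Σ-swap (x ∷ xs) ys f = trans (+-congˡ (Σ-swap xs ys f)) (sym (Σ-+ ys (f x) _))

  fromℕ : ℕ → Carrier
  fromℕ = ringFromℕ R

  fromℕ-+ : ∀ m n → fromℕ (m ℕ.+ n) ≈ fromℕ m + fromℕ n
  fromℕ-+ zero    n = sym (+-identityˡ _)
  fromℕ-+ (suc m) n = trans (+-congˡ (fromℕ-+ m n)) (sym (+-assoc _ _ _))

  fromℕ-* : ∀ m n → fromℕ (m ℕ.* n) ≈ fromℕ m * fromℕ n
  fromℕ-* zero    n = sym (zeroˡ _)
  fromℕ-* (suc m) n = trans (fromℕ-+ n (m ℕ.* n))
    (trans (+-cong (sym (*-identityˡ _)) (fromℕ-* m n)) (sym (distribʳ _ _ _)))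

  Σ-const : (xs : List A) (k : Carrier) → Σ xs (λ _ → k) ≈ fromℕ (length xs) * k
  Σ-const []       k = sym (zeroˡ k)
  Σ-const (x ∷ xs) k = trans (+-cong (sym (*-identityˡ k)) (Σ-const xs k)) (sym (distribʳ _ _ _))

  eval : List (Carrier × B) → (B → Carrier) → Carrier
  eval v f = Σ v (λ { (a , x) → a * f x })

  eval-Σ : (v : List (Carrier × B)) (xs : List A) (g : B → A → Carrier) →
           eval v (λ b → Σ xs (g b)) ≈ Σ xs (λ x → eval v (λ b → g b x))
  eval-Σ v xs g = trans (Σ-cong v (λ p → Σ-*ˡ (proj₁ p) xs _)) (Σ-swap v xs _)

  Σ₁ : ℕ → (ℕ → Carrier) → Carrier
  Σ₁ zero    a = 0#
  Σ₁ (suc N) a = Σ₁ N a + a (suc N)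

  Σ₁-zero : ∀ N {a} → (∀ k → a (suc k) ≈ 0#) → Σ₁ N a ≈ 0#
  Σ₁-zero zero    h = refl
  Σ₁-zero (suc N) h = trans (+-cong (Σ₁-zero N h) (h N)) (+-identityʳ _)

  Σ₁-below : ∀ N k {a} → (∀ j → j ≢ k → a j ≈ 0#) → N < k → Σ₁ N a ≈ 0#
  Σ₁-below zero    k h lt = refl
  Σ₁-below (suc N) k h lt =
    trans (+-cong (Σ₁-below N k h (ℕP.<-trans (ℕP.n<1+n N) lt)) (h (suc N) (ℕP.<⇒≢ lt))) (+-identityʳ _)

  Σ₁-single : ∀ N k {a} → 0 < k → (∀ j → j ≢ k → a j ≈ 0#) → k ≤ N → Σ₁ N a ≈ a k
  Σ₁-single zero    k pos h le with () ← ℕP.<⇒≱ pos le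
  Σ₁-single (suc N) k pos h le with suc N ℕ.≟ k
  ... | yes ≡.refl = trans (+-congʳ (Σ₁-below N (suc N) h (ℕP.n<1+n N))) (+-identityˡ _)
  ... | no  N+1≢k  = trans (+-cong (Σ₁-single N k pos h (ℕP.≤-pred (ℕP.≤∧≢⇒< le (λ e → N+1≢k (≡.sym e)))))
                                   (h (suc N) N+1≢k))
                           (+-identityʳ _)

  Σ-splits-left : (xs : List A) (h : List A × List A → Carrier) → (∀ s y ys → h (s , y ∷ ys) ≈ 0#) →
                  Σ (splits xs) h ≈ h (xs , [])
  Σ-splits-left []       h h-0 = +-identityʳ _
  Σ-splits-left (y ∷ ys) h h-0 = trans (Σ-concatMap (splits ys) _ h)
    (trans (Σ-cong (splits ys) (λ st → trans (+-congˡ (trans (+-identityʳ _) (h-0 (proj₁ st) y (proj₂ st))))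
                                             (+-identityʳ _)))
      (Σ-splits-left ys (λ st → h (y ∷ proj₁ st , proj₂ st)) (λ s → h-0 (y ∷ s))))

  Σ-splits-right : (xs : List A) (h : List A × List A → Carrier) → (∀ y ys t → h (y ∷ ys , t) ≈ 0#) →
                   Σ (splits xs) h ≈ h ([] , xs)
  Σ-splits-right []       h h-0 = +-identityʳ _
  Σ-splits-right (y ∷ ys) h h-0 = trans (Σ-concatMap (splits ys) _ h)
    (trans (Σ-cong (splits ys) (λ st → trans (+-congʳ (h-0 y (proj₁ st) (proj₂ st)))
                                             (trans (+-identityˡ _) (+-identityʳ _))))
      (Σ-splits-right ys (λ st → h (proj₁ st , y ∷ proj₂ st)) (λ y′ ys′ t → h-0 y′ ys′ (y ∷ t))))

-- The pairing of index multisets, as a count of index-preserving bijections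

module Matchings {c ℓ} (R : CommutativeRing c ℓ) where
  open CommutativeRing R hiding (zero)
  open FiniteSums R
  open import Algebra.Properties.CommutativeSemigroup +-commutativeSemigroup
    using (interchange; x∙yz≈y∙xz)
  open import Relation.Binary.Reasoning.Setoid setoid

  δ : ℕ → ℕ → Carrier
  δ i j = if i ℕ.≡ᵇ j then 1# else 0#

  δ-*-cong : ∀ i j {x y} → (i ≡ j → x ≈ y) → δ i j * x ≈ δ i j * y
  δ-*-cong i j h with i ℕ.≡ᵇ j in i≡ᵇj
  ... | true  = *-congˡ (h (≡ᵇ⇒≡ i j i≡ᵇj))
  ... | false = trans (zeroˡ _) (sym (zeroˡ _))

  δ-*-zero : ∀ i j {x} → (i ≡ j → x ≈ 0#) → δ i j * x ≈ 0#
  δ-*-zero i j h = trans (δ-*-cong i j h) (zeroʳ _)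

  matchings : List ℕ → List ℕ → Carrier
  matchings []       []      = 1#
  matchings []       (_ ∷ _) = 0#
  matchings (i ∷ is) js      = Σ (picks js) (λ p → δ i (proj₁ p) * matchings is (proj₂ p))

  Σ-picks-++ : (xs ys : List A) (h : A × List A → Carrier) →
    Σ (picks (xs ++ ys)) h
      ≈ Σ (picks xs) (λ p → h (proj₁ p , proj₂ p ++ ys)) + Σ (picks ys) (λ p → h (proj₁ p , xs ++ proj₂ p))
  Σ-picks-++ []       ys h = sym (+-identityˡ _)
  Σ-picks-++ (x ∷ xs) ys h = begin
    h (x , xs ++ ys) + Σ (map _ (picks (xs ++ ys))) h
      ≈⟨ +-congˡ (Σ-map (picks (xs ++ ys)) _ h) ⟩
    h (x , xs ++ ys) + Σ (picks (xs ++ ys)) (λ p → h (proj₁ p , x ∷ proj₂ p))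
      ≈⟨ +-congˡ (Σ-picks-++ xs ys (λ p → h (proj₁ p , x ∷ proj₂ p))) ⟩
    h (x , xs ++ ys) + (Σ (picks xs) (λ p → h (proj₁ p , x ∷ proj₂ p ++ ys))
                        + Σ (picks ys) (λ p → h (proj₁ p , x ∷ xs ++ proj₂ p)))
      ≈⟨ sym (+-assoc _ _ _) ⟩
    (h (x , xs ++ ys) + Σ (picks xs) (λ p → h (proj₁ p , x ∷ proj₂ p ++ ys)))
      + Σ (picks ys) (λ p → h (proj₁ p , x ∷ xs ++ proj₂ p))
      ≈⟨ +-congʳ (+-congˡ (sym (Σ-map (picks xs) _ _))) ⟩
    _ ∎

  matchings-++ : ∀ is xs ys →
    matchings is (xs ++ ys) ≈ Σ (splits is) (λ st → matchings (proj₁ st) xs * matchings (proj₂ st) ys)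
  matchings-++ [] [] []      = sym (trans (+-identityʳ _) (*-identityˡ _))
  matchings-++ [] [] (_ ∷ _) = sym (trans (+-identityʳ _) (zeroʳ _))
  matchings-++ [] (_ ∷ _) ys = sym (trans (+-identityʳ _) (zeroˡ _))
  matchings-++ (i ∷ is) xs ys = begin
    Σ (picks (xs ++ ys)) (λ p → δ i (proj₁ p) * matchings is (proj₂ p))
      ≈⟨ Σ-picks-++ xs ys _ ⟩
    Σ (picks xs) (λ p → δ i (proj₁ p) * matchings is (proj₂ p ++ ys))
      + Σ (picks ys) (λ p → δ i (proj₁ p) * matchings is (xs ++ proj₂ p))
      ≈⟨ +-cong
           (trans (Σ-cong (picks xs) (λ p → trans (*-congˡ (matchings-++ is (proj₂ p) ys)) (Σ-*ˡ _ (splits is) _)))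
                  (Σ-swap (picks xs) (splits is) _))
           (trans (Σ-cong (picks ys) (λ p → trans (*-congˡ (matchings-++ is xs (proj₂ p))) (Σ-*ˡ _ (splits is) _)))
                  (Σ-swap (picks ys) (splits is) _)) ⟩
    Σ (splits is) (λ st → Σ (picks xs) (λ p → δ i (proj₁ p) * (matchings (proj₁ st) (proj₂ p) * matchings (proj₂ st) ys)))
      + Σ (splits is) (λ st → Σ (picks ys) (λ p → δ i (proj₁ p) * (matchings (proj₁ st) xs * matchings (proj₂ st) (proj₂ p))))
      ≈⟨ sym (Σ-+ (splits is) _ _) ⟩
    Σ (splits is) (λ st → Σ (picks xs) (λ p → δ i (proj₁ p) * (matchings (proj₁ st) (proj₂ p) * matchings (proj₂ st) ys))
                       + Σ (picks ys) (λ p → δ i (proj₁ p) * (matchings (proj₁ st) xs * matchings (proj₂ st) (proj₂ p))))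
      ≈⟨ Σ-cong (splits is) (λ st → +-cong
           (trans (Σ-cong (picks xs) (λ _ → sym (*-assoc _ _ _))) (sym (Σ-*ʳ _ (picks xs) _)))
           (trans (Σ-cong (picks ys) (λ _ → x∙yz≈y∙xz* _ _ _)) (sym (Σ-*ˡ _ (picks ys) _)))) ⟩
    Σ (splits is) (λ st → matchings (i ∷ proj₁ st) xs * matchings (proj₂ st) ys
                       + matchings (proj₁ st) xs * matchings (i ∷ proj₂ st) ys)
      ≈⟨ Σ-cong (splits is) (λ _ → +-congˡ (sym (+-identityʳ _))) ⟩
    Σ (splits is) (λ st → matchings (i ∷ proj₁ st) xs * matchings (proj₂ st) ys
                       + (matchings (proj₁ st) xs * matchings (i ∷ proj₂ st) ys + 0#))
      ≈⟨ sym (Σ-concatMap (splits is) _ _) ⟩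
    Σ (splits (i ∷ is)) (λ st → matchings (proj₁ st) xs * matchings (proj₂ st) ys) ∎
    where
    open import Algebra.Properties.CommutativeSemigroup *-commutativeSemigroup
      using () renaming (x∙yz≈y∙xz to x∙yz≈y∙xz*)

  Σ-picks-↭ : {xs ys : List A} → xs ↭ ys → (f : A → List A → Carrier) →
    (∀ q {r r′} → r ↭ r′ → f q r ≈ f q r′) →
    Σ (picks xs) (λ p → f (proj₁ p) (proj₂ p)) ≈ Σ (picks ys) (λ p → f (proj₁ p) (proj₂ p))
  Σ-picks-↭ Perm.refl f f-↭ = refl
  Σ-picks-↭ {xs = _ ∷ xs} {ys = _ ∷ ys} (Perm.prep x p) f f-↭ =
    +-cong (f-↭ x p) (trans (Σ-map (picks xs) _ _)
      (trans (Σ-picks-↭ p (λ q r → f q (x ∷ r)) (λ q e → f-↭ q (↭-prep x e))) (sym (Σ-map (picks ys) _ _))))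
  Σ-picks-↭ {xs = x ∷ y ∷ xs} {ys = _ ∷ _ ∷ ys} (Perm.swap x y p) f f-↭ = begin
    f x (y ∷ xs) + (f y (x ∷ xs) + Σ (map _ (map _ (picks xs))) (λ p → f (proj₁ p) (proj₂ p)))
      ≈⟨ x∙yz≈y∙xz _ _ _ ⟩
    f y (x ∷ xs) + (f x (y ∷ xs) + Σ (map _ (map _ (picks xs))) (λ p → f (proj₁ p) (proj₂ p)))
      ≈⟨ +-cong (f-↭ y (↭-prep x p)) (+-cong (f-↭ x (↭-prep y p))
           (trans (Σ-map (map _ (picks xs)) _ _) (Σ-map (picks xs) _ _))) ⟩
    f y (x ∷ ys) + (f x (y ∷ ys) + Σ (picks xs) (λ p → f (proj₁ p) (x ∷ y ∷ proj₂ p)))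
      ≈⟨ +-congˡ (+-congˡ (trans
           (Σ-picks-↭ p (λ q r → f q (x ∷ y ∷ r)) (λ q e → f-↭ q (↭-prep x (↭-prep y e))))
           (Σ-cong (picks ys) (λ p → f-↭ (proj₁ p) (↭-swap x y ↭-refl))))) ⟩
    f y (x ∷ ys) + (f x (y ∷ ys) + Σ (picks ys) (λ p → f (proj₁ p) (y ∷ x ∷ proj₂ p)))
      ≈⟨ +-congˡ (+-congˡ (sym (trans (Σ-map (map _ (picks ys)) _ _) (Σ-map (picks ys) _ _)))) ⟩
    f y (x ∷ ys) + (f x (y ∷ ys) + Σ (map _ (map _ (picks ys))) (λ p → f (proj₁ p) (proj₂ p))) ∎
  Σ-picks-↭ (Perm.trans p q) f f-↭ = trans (Σ-picks-↭ p f f-↭) (Σ-picks-↭ q f f-↭)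

  matchings-↭ʳ : ∀ is {js js′} → js ↭ js′ → matchings is js ≈ matchings is js′
  matchings-↭ʳ [] {[]}    {[]}    p = refl
  matchings-↭ʳ [] {[]}    {_ ∷ _} p with () ← ↭-length p
  matchings-↭ʳ [] {_ ∷ _} {[]}    p with () ← ↭-length p
  matchings-↭ʳ [] {_ ∷ _} {_ ∷ _} p = refl
  matchings-↭ʳ (i ∷ is) p =
    Σ-picks-↭ p (λ q r → δ i q * matchings is r) (λ q e → *-congˡ (matchings-↭ʳ is e))

  Σ-δ-picks : ∀ i js → Σ (picks js) (λ p → δ i (proj₁ p)) ≈ fromℕ (count i js)
  Σ-δ-picks i [] = refl
  Σ-δ-picks i (j ∷ js) with i ℕ.≡ᵇ j
  ... | true  = +-congˡ (trans (Σ-map (picks js) _ _) (Σ-δ-picks i js))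
  ... | false = trans (+-identityˡ _) (trans (Σ-map (picks js) _ _) (Σ-δ-picks i js))

  count-∷ : ∀ i is → count i (i ∷ is) ≡ suc (count i is)
  count-∷ i is = ≡.cong (if_then suc (count i is) else count i is) (≡ᵇ-refl i)

  pairIdx : List ℕ → List ℕ → Carrier
  pairIdx is js = if sameMS is js then fromℕ (mfact is) else 0#

  matchings≈pairIdx : ∀ is js → matchings is js ≈ pairIdx is js
  matchings≈pairIdx []       []      = sym (+-identityʳ _)
  matchings≈pairIdx []       (_ ∷ _) = refl
  matchings≈pairIdx (i ∷ is) js      =
    trans (Σ-cong (picks js) (λ p → *-congˡ (matchings≈pairIdx is (proj₂ p))))
          (by-cases (sameMS (i ∷ is) js) ≡.refl)
    where
    by-cases : ∀ b → sameMS (i ∷ is) js ≡ b →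
      Σ (picks js) (λ p → δ i (proj₁ p) * pairIdx is (proj₂ p)) ≈ pairIdx (i ∷ is) js
    by-cases true same = begin
      Σ (picks js) (λ p → δ i (proj₁ p) * pairIdx is (proj₂ p))
        ≈⟨ Σ-cong-All (picks js) (All.map (λ {p} js↭ → δ-*-cong i (proj₁ p) λ { ≡.refl →
             reflexive (≡.cong (if_then fromℕ (mfact is) else 0#)
               (↭⇒sameMS is (proj₂ p) (drop-∷ (↭-trans i∷is↭js js↭)))) }) (picks-↭ js)) ⟩
      Σ (picks js) (λ p → δ i (proj₁ p) * fromℕ (mfact is))
        ≈⟨ sym (Σ-*ʳ _ (picks js) _) ⟩
      Σ (picks js) (λ p → δ i (proj₁ p)) * fromℕ (mfact is)
        ≈⟨ *-congʳ (Σ-δ-picks i js) ⟩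
      fromℕ (count i js) * fromℕ (mfact is)
        ≡⟨ ≡.cong (λ n → fromℕ n * fromℕ (mfact is)) (≡.trans (≡.sym (count-↭ i i∷is↭js)) (count-∷ i is)) ⟩
      fromℕ (suc (count i is)) * fromℕ (mfact is)
        ≈⟨ sym (fromℕ-* (suc (count i is)) (mfact is)) ⟩
      fromℕ (mfact (i ∷ is))
        ≡⟨ ≡.cong (if_then fromℕ (mfact (i ∷ is)) else 0#) same ⟨
      pairIdx (i ∷ is) js ∎
      where
      i∷is↭js : i ∷ is ↭ js
      i∷is↭js = sameMS⇒↭ _ _ same
    by-cases false notSame = trans
      (Σ-zero-All (picks js) (All.map (λ {p} js↭ → δ-*-zero i (proj₁ p) λ { ≡.refl →
         unmatched (proj₂ p) js↭ (sameMS is (proj₂ p)) ≡.refl }) (picks-↭ js)))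
      (reflexive (≡.cong (if_then fromℕ (mfact (i ∷ is)) else 0#) (≡.sym notSame)))
      where
      unmatched : ∀ r → js ↭ i ∷ r → ∀ b → sameMS is r ≡ b → pairIdx is r ≈ 0#
      unmatched r js↭ true same with () ← ≡.trans (≡.sym notSame)
        (↭⇒sameMS (i ∷ is) js (↭-trans (↭-prep i (sameMS⇒↭ is r same)) (↭-sym js↭)))
      unmatched r js↭ false same = reflexive (≡.cong (if_then fromℕ (mfact is) else 0#) same)

  Σ-incAllL-↭ : ∀ {xs ys} → xs ↭ ys → (h : List ℕ → Carrier) → (∀ {r r′} → r ↭ r′ → h r ≈ h r′) →
    Σ (incAllL xs) h ≈ Σ (incAllL ys) h
  Σ-incAllL-↭ Perm.refl h h-↭ = refl
  Σ-incAllL-↭ {_ ∷ xs} {_ ∷ ys} (Perm.prep x p) h h-↭ =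
    +-cong (h-↭ (↭-prep (suc x) p)) (trans (Σ-map (incAllL xs) _ _)
      (trans (Σ-incAllL-↭ p (λ r → h (x ∷ r)) (λ e → h-↭ (↭-prep x e))) (sym (Σ-map (incAllL ys) _ _))))
  Σ-incAllL-↭ {x ∷ y ∷ xs} {_ ∷ _ ∷ ys} (Perm.swap x y p) h h-↭ = begin
    h (suc x ∷ y ∷ xs) + (h (x ∷ suc y ∷ xs) + Σ (map _ (map _ (incAllL xs))) h)
      ≈⟨ x∙yz≈y∙xz _ _ _ ⟩
    h (x ∷ suc y ∷ xs) + (h (suc x ∷ y ∷ xs) + Σ (map _ (map _ (incAllL xs))) h)
      ≈⟨ +-cong (h-↭ (↭-swap x (suc y) p)) (+-cong (h-↭ (↭-swap (suc x) y p))
           (trans (Σ-map (map _ (incAllL xs)) _ _) (Σ-map (incAllL xs) _ _))) ⟩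
    h (suc y ∷ x ∷ ys) + (h (y ∷ suc x ∷ ys) + Σ (incAllL xs) (λ r → h (x ∷ y ∷ r)))
      ≈⟨ +-congˡ (+-congˡ (trans
           (Σ-incAllL-↭ p (λ r → h (x ∷ y ∷ r)) (λ e → h-↭ (↭-prep x (↭-prep y e))))
           (Σ-cong (incAllL ys) (λ r → h-↭ (↭-swap x y ↭-refl))))) ⟩
    h (suc y ∷ x ∷ ys) + (h (y ∷ suc x ∷ ys) + Σ (incAllL ys) (λ r → h (y ∷ x ∷ r)))
      ≈⟨ +-congˡ (+-congˡ (sym (trans (Σ-map (map _ (incAllL ys)) _ _) (Σ-map (incAllL ys) _ _)))) ⟩
    h (suc y ∷ x ∷ ys) + (h (y ∷ suc x ∷ ys) + Σ (map _ (map _ (incAllL ys))) h) ∎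
  Σ-incAllL-↭ (Perm.trans p q) h h-↭ = trans (Σ-incAllL-↭ p h h-↭) (Σ-incAllL-↭ q h h-↭)

  Σ-incAllL-++ : ∀ xs ys (h : List ℕ → Carrier) →
    Σ (incAllL (xs ++ ys)) h ≈ Σ (incAllL xs) (λ e → h (e ++ ys)) + Σ (incAllL ys) (λ e → h (xs ++ e))
  Σ-incAllL-++ []       ys h = sym (+-identityˡ _)
  Σ-incAllL-++ (x ∷ xs) ys h = begin
    h (suc x ∷ xs ++ ys) + Σ (map (x ∷_) (incAllL (xs ++ ys))) h
      ≈⟨ +-congˡ (trans (Σ-map (incAllL (xs ++ ys)) _ _) (Σ-incAllL-++ xs ys (λ e → h (x ∷ e)))) ⟩
    h (suc x ∷ xs ++ ys) + (Σ (incAllL xs) (λ e → h (x ∷ e ++ ys)) + Σ (incAllL ys) (λ e → h (x ∷ xs ++ e)))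
      ≈⟨ sym (+-assoc _ _ _) ⟩
    (h (suc x ∷ xs ++ ys) + Σ (incAllL xs) (λ e → h (x ∷ e ++ ys))) + Σ (incAllL ys) (λ e → h (x ∷ xs ++ e))
      ≈⟨ +-congʳ (+-congˡ (sym (Σ-map (incAllL xs) _ _))) ⟩
    (h (suc x ∷ xs ++ ys) + Σ (map (x ∷_) (incAllL xs)) (λ e → h (e ++ ys))) + Σ (incAllL ys) (λ e → h (x ∷ xs ++ e)) ∎

  Σ-incAllL-picks : ∀ js (f : ℕ → List ℕ → Carrier) →
    Σ (incAllL js) (λ ks → Σ (picks ks) (λ p → f (proj₁ p) (proj₂ p)))
      ≈ Σ (picks js) (λ p → f (suc (proj₁ p)) (proj₂ p) + Σ (incAllL (proj₂ p)) (f (proj₁ p)))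
  Σ-incAllL-picks [] f = refl
  Σ-incAllL-picks (y ∷ ys) f = begin
    (f (suc y) ys + Σ (map _ (picks ys)) (λ p → f (proj₁ p) (proj₂ p)))
      + Σ (map (y ∷_) (incAllL ys)) (λ ks → Σ (picks ks) (λ p → f (proj₁ p) (proj₂ p)))
      ≈⟨ +-cong (+-congˡ (Σ-map (picks ys) _ _)) (Σ-map (incAllL ys) _ _) ⟩
    (f (suc y) ys + Σ (picks ys) (λ p → f (proj₁ p) (suc y ∷ proj₂ p)))
      + Σ (incAllL ys) (λ ks → f y ks + Σ (map _ (picks ks)) (λ p → f (proj₁ p) (proj₂ p)))
      ≈⟨ +-congˡ (trans (Σ-cong (incAllL ys) (λ ks → +-congˡ (Σ-map (picks ks) _ _))) (Σ-+ (incAllL ys) _ _)) ⟩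
    (f (suc y) ys + Σ (picks ys) (λ p → f (proj₁ p) (suc y ∷ proj₂ p)))
      + (Σ (incAllL ys) (f y) + Σ (incAllL ys) (λ ks → Σ (picks ks) (λ p → f (proj₁ p) (y ∷ proj₂ p))))
      ≈⟨ +-congˡ (+-congˡ (Σ-incAllL-picks ys (λ q r → f q (y ∷ r)))) ⟩
    (f (suc y) ys + Σ (picks ys) (λ p → f (proj₁ p) (suc y ∷ proj₂ p)))
      + (Σ (incAllL ys) (f y) + Σ (picks ys) (λ p → f (suc (proj₁ p)) (y ∷ proj₂ p)
                                               + Σ (incAllL (proj₂ p)) (λ r → f (proj₁ p) (y ∷ r))))
      ≈⟨ interchange _ _ _ _ ⟩
    (f (suc y) ys + Σ (incAllL ys) (f y))
      + (Σ (picks ys) (λ p → f (proj₁ p) (suc y ∷ proj₂ p))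
         + Σ (picks ys) (λ p → f (suc (proj₁ p)) (y ∷ proj₂ p) + Σ (incAllL (proj₂ p)) (λ r → f (proj₁ p) (y ∷ r))))
      ≈⟨ +-congˡ (sym (Σ-+ (picks ys) _ _)) ⟩
    (f (suc y) ys + Σ (incAllL ys) (f y))
      + Σ (picks ys) (λ p → f (proj₁ p) (suc y ∷ proj₂ p)
                            + (f (suc (proj₁ p)) (y ∷ proj₂ p) + Σ (incAllL (proj₂ p)) (λ r → f (proj₁ p) (y ∷ r))))
      ≈⟨ +-congˡ (Σ-cong (picks ys) (λ p → trans (x∙yz≈y∙xz _ _ _)
           (+-congˡ (+-congˡ (sym (Σ-map (incAllL (proj₂ p)) _ _)))))) ⟩
    (f (suc y) ys + Σ (incAllL ys) (f y))
      + Σ (picks ys) (λ p → f (suc (proj₁ p)) (y ∷ proj₂ p)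
                            + (f (proj₁ p) (suc y ∷ proj₂ p) + Σ (map (y ∷_) (incAllL (proj₂ p))) (f (proj₁ p))))
      ≈⟨ +-congˡ (sym (Σ-map (picks ys) _ _)) ⟩
    (f (suc y) ys + Σ (incAllL ys) (f y))
      + Σ (map _ (picks ys)) (λ p → f (suc (proj₁ p)) (proj₂ p) + Σ (incAllL (proj₂ p)) (f (proj₁ p))) ∎

  matchings-[]-incAllL : ∀ js → Σ (incAllL js) (matchings []) ≈ 0#
  matchings-[]-incAllL []       = refl
  matchings-[]-incAllL (_ ∷ js) = trans (+-identityˡ _) (trans (Σ-map (incAllL js) _ _) (Σ-0 (incAllL js)))

  decAllL-adjoint : ∀ is js → Σ (decAllL is) (λ is′ → matchings is′ js) ≈ Σ (incAllL js) (matchings is)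
  decAllL-adjoint-scaled : ∀ a is js → Σ (decAllL is) (λ is′ → a * matchings is′ js)
                                     ≈ Σ (incAllL js) (λ js′ → a * matchings is js′)

  decAllL-adjoint-scaled a is js = trans (sym (Σ-*ˡ a (decAllL is) _))
    (trans (*-congˡ (decAllL-adjoint is js)) (Σ-*ˡ a (incAllL js) _))

  decAllL-adjoint [] js = sym (matchings-[]-incAllL js)
  decAllL-adjoint (zero ∷ is) js = begin
    Σ (map (zero ∷_) (decAllL is)) (λ is′ → matchings is′ js)
      ≈⟨ Σ-map (decAllL is) _ _ ⟩
    Σ (decAllL is) (λ is′ → Σ (picks js) (λ p → δ 0 (proj₁ p) * matchings is′ (proj₂ p)))
      ≈⟨ Σ-swap (decAllL is) (picks js) _ ⟩
    Σ (picks js) (λ p → Σ (decAllL is) (λ is′ → δ 0 (proj₁ p) * matchings is′ (proj₂ p)))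
      ≈⟨ Σ-cong (picks js) (λ p → decAllL-adjoint-scaled (δ 0 (proj₁ p)) is (proj₂ p)) ⟩
    Σ (picks js) (λ p → Σ (incAllL (proj₂ p)) (λ r → δ 0 (proj₁ p) * matchings is r))
      ≈⟨ Σ-cong (picks js) (λ p → trans (sym (+-identityˡ _)) (+-congʳ (sym (zeroˡ _)))) ⟩
    Σ (picks js) (λ p → δ 0 (suc (proj₁ p)) * matchings is (proj₂ p)
                        + Σ (incAllL (proj₂ p)) (λ r → δ 0 (proj₁ p) * matchings is r))
      ≈⟨ sym (Σ-incAllL-picks js (λ q r → δ 0 q * matchings is r)) ⟩
    Σ (incAllL js) (matchings (zero ∷ is)) ∎
  decAllL-adjoint (suc i ∷ is) js = begin
    Σ (picks js) (λ p → δ i (proj₁ p) * matchings is (proj₂ p))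
      + Σ (map (suc i ∷_) (decAllL is)) (λ is′ → matchings is′ js)
      ≈⟨ +-congˡ (Σ-map (decAllL is) _ _) ⟩
    Σ (picks js) (λ p → δ i (proj₁ p) * matchings is (proj₂ p))
      + Σ (decAllL is) (λ is′ → Σ (picks js) (λ p → δ (suc i) (proj₁ p) * matchings is′ (proj₂ p)))
      ≈⟨ +-congˡ (Σ-swap (decAllL is) (picks js) _) ⟩
    Σ (picks js) (λ p → δ i (proj₁ p) * matchings is (proj₂ p))
      + Σ (picks js) (λ p → Σ (decAllL is) (λ is′ → δ (suc i) (proj₁ p) * matchings is′ (proj₂ p)))
      ≈⟨ +-congˡ (Σ-cong (picks js) (λ p → decAllL-adjoint-scaled (δ (suc i) (proj₁ p)) is (proj₂ p))) ⟩
    Σ (picks js) (λ p → δ i (proj₁ p) * matchings is (proj₂ p))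
      + Σ (picks js) (λ p → Σ (incAllL (proj₂ p)) (λ r → δ (suc i) (proj₁ p) * matchings is r))
      ≈⟨ sym (Σ-+ (picks js) _ _) ⟩
    Σ (picks js) (λ p → δ (suc i) (suc (proj₁ p)) * matchings is (proj₂ p)
                        + Σ (incAllL (proj₂ p)) (λ r → δ (suc i) (proj₁ p) * matchings is r))
      ≈⟨ sym (Σ-incAllL-picks js (λ q r → δ (suc i) q * matchings is r)) ⟩
    Σ (incAllL js) (matchings (suc i ∷ is)) ∎

module _ {c ℓ} (F : CharZeroField c ℓ) where
  open CharZeroField F hiding (zero; fromℕ)
  open WithField F
  open FiniteSums commutativeRing
  open Matchings commutativeRing
  open import Algebra.Properties.Ring ring using (-‿distribˡ-*)
  open import Relation.Binary.Reasoning.Setoid setoid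

  eval-scale : {B : Set} (a : Carrier) (w : Lin B) (f : B → Carrier) →
               eval (scale a w) f ≈ a * eval w f
  eval-scale a w f =
    trans (Σ-map w _ _) (trans (Σ-cong w (λ _ → *-assoc _ _ _)) (sym (Σ-*ˡ a w _)))

  eval-bind : {A B : Set} (v : Lin A) (g : A → Lin B) (f : B → Carrier) →
              eval (bind v g) f ≈ eval v (λ x → eval (g x) f)
  eval-bind v g f =
    trans (Σ-concatMap v _ _) (Σ-cong v (λ p → eval-scale (proj₁ p) (g (proj₂ p)) f))

  eval-neg : {B : Set} (v : Lin B) (f : B → Carrier) → eval (neg v) f ≈ - eval v f
  eval-neg v f = trans (Σ-map v _ _)
    (trans (Σ-cong v (λ _ → sym (-‿distribˡ-* _ _))) (sym (Σ-neg v _)))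

  AllTerms : {B : Set} → (B → Set) → Lin B → Set c
  AllTerms Q v = All (λ t → Q (proj₂ t)) v

  AllTerms-bind : {A B : Set} {Q : A → Set} {R : B → Set} (v : Lin A) (f : A → Lin B) →
    AllTerms Q v → (∀ x → Q x → AllTerms R (f x)) → AllTerms R (bind v f)
  AllTerms-bind []            f []       h = []
  AllTerms-bind ((a , x) ∷ v) f (q ∷ qs) h = AllP.++⁺ (AllP.map⁺ (h x q)) (AllTerms-bind v f qs h)

  -- Homogeneity of the Grossman–Larson product for an additive grading

  module Grading (G : Mono → ℤ)
                 (G-↭ : ∀ {m n} → toList m ↭ toList n → G m ≡ G n)
                 (G-preLie : ∀ M y → All (λ M′ → G (M′ ⁺++⁺ y) ≡ G M +ℤ G y) (incAll M))
                 where
    open import Algebra.Properties.CommutativeSemigroup ℤP.+-commutativeSemigroup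
      using (interchange; x∙yz≈y∙xz; xy∙z≈x∙zy)
    open import Algebra.Properties.Group (AbelianGroup.group ℤP.+-0-abelianGroup) using (∙-cancelˡ)

    GW : Word → ℤ
    GW w = List.foldr _+ℤ_ (ℤ.+ 0) (map G w)

    GW-++ : ∀ s t → GW (s ++ t) ≡ GW s +ℤ GW t
    GW-++ []      t = ≡.sym (ℤP.+-identityˡ (GW t))
    GW-++ (m ∷ s) t = ≡.trans (≡.cong (G m +ℤ_) (GW-++ s t)) (≡.sym (ℤP.+-assoc (G m) (GW s) (GW t)))

    GW-↭ : ∀ {s t} → s ↭ t → GW s ≡ GW t
    GW-↭ p = foldr-commMonoid (≡.setoid ℤ) ℤP.+-0-isCommutativeMonoid (↭⇒↭ₛ (↭-map⁺ G p))

    GW-splits : ∀ w → All (λ st → GW (proj₁ st) +ℤ GW (proj₂ st) ≡ GW w) (splits w)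
    GW-splits w = All.map (λ {st} p → ≡.trans (≡.sym (GW-++ (proj₁ st) (proj₂ st))) (GW-↭ p)) (splits-↭ w)

    preLie-graded : ∀ M y → AllTerms (λ m → G m ≡ G M +ℤ G y) (preLie M y)
    preLie-graded M y = AllP.map⁺ (G-preLie M y)

    goR-graded : ∀ n x rs → AllTerms (λ m → G m ≡ G x +ℤ GW rs) (goR n x rs)
    goR-graded n       x []       = ≡.sym (ℤP.+-identityʳ (G x)) ∷ []
    goR-graded zero    x (_ ∷ _)  = []
    goR-graded (suc n) x (y ∷ rs) = AllP.++⁺ derived (AllP.map⁺ corrections)
      where
      derived : AllTerms (λ m → G m ≡ G x +ℤ GW (y ∷ rs)) (preLieP (goR n x rs) y)
      derived = AllTerms-bind (goR n x rs) _ (goR-graded n x rs) λ M GM≡ →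
        All.map (λ e → ≡.trans e (≡.trans (≡.cong (ℤ._+ G y) GM≡) (xy∙z≈x∙zy (G x) (GW rs) (G y))))
                (preLie-graded M y)
      replaced-grade : ∀ yᵢ put m → yᵢ ∷ put m ↭ m ∷ rs → G m ≡ G yᵢ +ℤ G y →
                       GW (put m) ≡ G y +ℤ GW rs
      replaced-grade yᵢ put m p e = ∙-cancelˡ (G yᵢ) _ _ (≡.trans (GW-↭ p)
        (≡.trans (≡.cong (ℤ._+ GW rs) e) (ℤP.+-assoc (G yᵢ) (G y) (GW rs))))
      corrections : AllTerms (λ m → G m ≡ G x +ℤ GW (y ∷ rs))
        (concatMap (λ { (yᵢ , put) → bind (preLie yᵢ y) (λ m → goR n x (put m)) }) (replacements rs))
      corrections = concatMap⁺ (All.map (λ {r} p →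
        AllTerms-bind (preLie (proj₁ r) y) _ (preLie-graded (proj₁ r) y) λ m e →
          All.map (λ e′ → ≡.trans e′ (≡.cong (G x +ℤ_) (replaced-grade (proj₁ r) (proj₂ r) m (p m) e)))
                  (goR-graded n x (proj₂ r m)))
        (replacements-↭ rs))

    actMono-graded : ∀ u s → AllTerms (λ m → G m ≡ G u +ℤ GW s) (actMono u s)
    actMono-graded u s = All.map (λ e → ≡.trans e (≡.cong (G u +ℤ_) (GW-↭ (↭-reverse s))))
                                 (goR-graded (length s) u (List.reverse s))

    act-graded : ∀ u w → AllTerms (λ W → GW W ≡ GW u +ℤ GW w) (act u w)
    act-graded []       []      = ≡.refl ∷ []
    act-graded []       (_ ∷ _) = []
    act-graded (u ∷ us) w = concatMap⁺ (All.map (λ {st} → split (proj₁ st) (proj₂ st)) (GW-splits w))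
      where
      split : ∀ s t → GW s +ℤ GW t ≡ GW w → AllTerms (λ W → GW W ≡ GW (u ∷ us) +ℤ GW w)
                (bar (map (λ { (a , m) → (a , m ∷ []) }) (actMono u s)) (act us t))
      split s t split≡ = AllTerms-bind {Q = λ a → GW a ≡ G u +ℤ GW s} _ _
        (AllP.map⁺ (All.map (λ e → ≡.trans (ℤP.+-identityʳ _) e) (actMono-graded u s)))
        λ a a≡ → AllP.map⁺ (All.map (λ {t′} e →
          ≡.trans (GW-++ a (proj₂ t′)) (≡.trans (≡.cong₂ _+ℤ_ a≡ e)
            (≡.trans (interchange (G u) _ _ _) (≡.cong (GW (u ∷ us) +ℤ_) split≡))))
          (act-graded us t))

    gl-graded : ∀ U V → AllTerms (λ W → GW W ≡ GW U +ℤ GW V) (gl U V)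
    gl-graded U V = concatMap⁺ (All.map (λ {st} split≡ → AllP.map⁺ (All.map (λ {t} e →
        ≡.trans (GW-++ (proj₁ st) (proj₂ t)) (≡.trans (≡.cong (GW (proj₁ st) +ℤ_) e)
          (≡.trans (x∙yz≈y∙xz (GW (proj₁ st)) (GW U) (GW (proj₂ st))) (≡.cong (GW U +ℤ_) split≡))))
        (act-graded U (proj₂ st))))
      (GW-splits V))

    pairW-graded : ∀ A u → GW A ≢ GW u → pairW A u ≈ 0#
    pairW-graded []       []      ne with () ← ne ≡.refl
    pairW-graded []       (_ ∷ _) ne = refl
    pairW-graded (p ∷ ps) qs      ne =
      Σ-zero-All (picks qs) (All.map (λ {r} → pick (proj₁ r) (proj₂ r)) (picks-↭ qs))
      where
      pick : ∀ q r → qs ↭ q ∷ r → pairMono p q * pairW ps r ≈ 0#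
      pick q r qs↭ with sameMS (toList p) (toList q) in same
      ... | false = zeroˡ _
      ... | true  = trans (*-congˡ (pairW-graded ps r λ e → ne
        (≡.trans (≡.cong₂ _+ℤ_ (G-↭ (sameMS⇒↭ _ _ same)) e) (≡.sym (GW-↭ qs↭))))) (zeroʳ _)

    ΔNMI-homogeneous : ∀ A U V → GW U +ℤ GW V ≢ GW A → ΔNMI ((1# , A) ∷ []) U V ≈ 0#
    ΔNMI-homogeneous A U V ne =
      trans (reflexive (≡.cong sumK (Listₚ.++-identityʳ (map pairing (gl U V)))))
        (Σ-zero-All (gl U V) (All.map (λ e →
          trans (*-congˡ (pairW-graded A _ λ e′ → ne (≡.sym (≡.trans e′ e)))) (zeroʳ _))
          (gl-graded U V)))
      where
      pairing : Carrier × Word → Carrier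
      pairing (b , u) = 1# * b * pairW A u

  ΔNMI-homogeneous-length : ∀ A U V → lenW U +ℕ lenW V ≢ lenW A → ΔNMI ((1# , A) ∷ []) U V ≈ 0#
  ΔNMI-homogeneous-length A U V ne =
    L.ΔNMI-homogeneous A U V λ e → ne (ℤP.+-injective (≡.trans (ℤP.pos-+ (lenW U) (lenW V))
      (≡.trans (≡.sym (≡.cong₂ _+ℤ_ (GW≡lenW U) (GW≡lenW V))) (≡.trans e (GW≡lenW A)))))
    where
    module L = Grading (λ m → ℤ.+ lenM m) (λ p → ≡.cong ℤ.+_ (lenM-↭ p))
                       (λ M y → All.map (λ e → ≡.trans (≡.cong ℤ.+_ e) (ℤP.pos-+ (lenM M) (lenM y))) (lenM-preLie M y))
    GW≡lenW : ∀ w → L.GW w ≡ ℤ.+ lenW w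
    GW≡lenW []      = ≡.refl
    GW≡lenW (m ∷ w) = ≡.trans (≡.cong (ℤ.+ lenM m +ℤ_) (GW≡lenW w)) (≡.sym (ℤP.pos-+ (lenM m) (lenW w)))

  ΔNMI-homogeneous-degree : ∀ A U V → degW U +ℤ degW V ≢ degW A → ΔNMI ((1# , A) ∷ []) U V ≈ 0#
  ΔNMI-homogeneous-degree = Grading.ΔNMI-homogeneous degM degM-↭ degM-preLie

  -- The Guin–Oudom extension on K[Xᵢ]₊

  Symmetric : (List ℕ → Carrier) → Set ℓ
  Symmetric f = ∀ {r r′} → r ↭ r′ → f r ≈ f r′

  Σ-incAll : ∀ M (g : List ℕ → Carrier) → Σ (incAll M) (λ M′ → g (toList M′)) ≈ Σ (incAllL (toList M)) g
  Σ-incAll M g = trans (sym (Σ-map (incAll M) toList g)) (reflexive (≡.cong (λ l → Σ l g) (toList-incAll M)))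

  eval-preLie : ∀ M y (f : List ℕ → Carrier) →
    eval (preLie M y) (λ m → f (toList m)) ≈ Σ (incAllL (toList M)) (λ l → f (l ++ toList y))
  eval-preLie M y f = trans (Σ-map (incAll M) _ _)
    (trans (Σ-cong (incAll M) (λ M′ → trans (*-identityˡ _) (reflexive (≡.cong f (toList-⁺++⁺ M′ y)))))
      (Σ-incAll M (λ l → f (l ++ toList y))))

  -- Replacing each factor rᵢ of r₁ ⋯ rₖ by D(rᵢ) y in turn yields D(r₁ ⋯ rₖ) y.
  Σ-replacements : ∀ (rs : Word) y (h : List ℕ → Carrier) → Symmetric h →
    Σ (replacements rs) (λ r → Σ (incAll (proj₁ r)) (λ M′ → h (flatten (proj₂ r (M′ ⁺++⁺ y)))))
      ≈ Σ (incAllL (flatten rs)) (λ l → h (l ++ toList y))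
  Σ-replacements [] y h h-sym = refl
  Σ-replacements (z ∷ zs) y h h-sym = begin
    Σ (incAll z) (λ M′ → h (toList (M′ ⁺++⁺ y) ++ flatten zs))
      + Σ (map _ (replacements zs)) (λ r → Σ (incAll (proj₁ r)) (λ M′ → h (flatten (proj₂ r (M′ ⁺++⁺ y)))))
      ≈⟨ +-cong (trans (Σ-cong (incAll z) (λ M′ → h-sym (↭-trans
                   (↭-reflexive (≡.cong (_++ flatten zs) (toList-⁺++⁺ M′ y)))
                   (move-last (toList M′) (toList y) (flatten zs)))))
                  (Σ-incAll z (λ l → h ((l ++ flatten zs) ++ toList y))))
                (trans (Σ-map (replacements zs) _ _)
                  (Σ-replacements zs y (λ l → h (toList z ++ l)) (λ p → h-sym (++⁺ˡ (toList z) p)))) ⟩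
    Σ (incAllL (toList z)) (λ l → h ((l ++ flatten zs) ++ toList y))
      + Σ (incAllL (flatten zs)) (λ l → h (toList z ++ (l ++ toList y)))
      ≈⟨ +-congˡ (Σ-cong (incAllL (flatten zs)) (λ l →
           reflexive (≡.cong h (≡.sym (Listₚ.++-assoc (toList z) l (toList y)))))) ⟩
    Σ (incAllL (toList z)) (λ l → h ((l ++ flatten zs) ++ toList y))
      + Σ (incAllL (flatten zs)) (λ l → h ((toList z ++ l) ++ toList y))
      ≈⟨ sym (Σ-incAllL-++ (toList z) (flatten zs) (λ l → h (l ++ toList y))) ⟩
    Σ (incAllL (toList z ++ flatten zs)) (λ l → h (l ++ toList y)) ∎
    where
    move-last : (xs ys zs : List ℕ) → (xs ++ ys) ++ zs ↭ (xs ++ zs) ++ ys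
    move-last xs ys zs = ↭-trans (↭-reflexive (Listₚ.++-assoc xs ys zs))
      (↭-trans (++⁺ˡ xs (++-comm ys zs)) (↭-sym (↭-reflexive (Listₚ.++-assoc xs zs ys))))

  -- x ◀ (y₁ | ⋯ | yₙ) = Dⁿ(x) y₁ ⋯ yₙ, tested against symmetric functionals; `goR` takes
  -- the word reversed.
  GuinOudom : ℕ → Mono → Word → Set (c ⊔ ℓ)
  GuinOudom n x rs = ∀ f → Symmetric f →
    eval (goR n x rs) (λ m → f (toList m)) ≈ Σ (incAllL^ (length rs) (toList x)) (λ d → f (d ++ flatten rs))

  goR-derived : ∀ n x rs y → GuinOudom n x rs → ∀ f → Symmetric f →
    eval (preLieP (goR n x rs) y) (λ m → f (toList m))
      ≈ Σ (incAllL^ (length rs) (toList x)) (λ d → Σ (incAllL d) (λ e → f ((e ++ flatten rs) ++ toList y)))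
      + Σ (incAllL^ (length rs) (toList x)) (λ d → Σ (incAllL (flatten rs)) (λ e → f (d ++ (e ++ toList y))))
  goR-derived n x rs y go f f-sym = begin
    eval (preLieP (goR n x rs) y) (λ m → f (toList m))
      ≈⟨ eval-bind (goR n x rs) (λ M → preLie M y) _ ⟩
    eval (goR n x rs) (λ M → eval (preLie M y) (λ m → f (toList m)))
      ≈⟨ Σ-cong (goR n x rs) (λ p → *-congˡ (eval-preLie (proj₂ p) y f)) ⟩
    eval (goR n x rs) (λ M → D-then-y (toList M))
      ≈⟨ go D-then-y (λ p → Σ-incAllL-↭ p (λ l → f (l ++ toList y)) (λ q → f-sym (++⁺ʳ (toList y) q))) ⟩
    Σ (incAllL^ (length rs) (toList x)) (λ d → D-then-y (d ++ flatten rs))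
      ≈⟨ Σ-cong (incAllL^ (length rs) (toList x)) (λ d → trans (Σ-incAllL-++ d (flatten rs) _)
           (+-congˡ (Σ-cong (incAllL (flatten rs)) (λ e →
             reflexive (≡.cong f (Listₚ.++-assoc d e (toList y))))))) ⟩
    Σ (incAllL^ (length rs) (toList x)) (λ d → Σ (incAllL d) (λ e → f ((e ++ flatten rs) ++ toList y))
                                            + Σ (incAllL (flatten rs)) (λ e → f (d ++ (e ++ toList y))))
      ≈⟨ Σ-+ (incAllL^ (length rs) (toList x)) _ _ ⟩
    _ ∎
    where
    D-then-y : List ℕ → Carrier
    D-then-y l = Σ (incAllL l) (λ l′ → f (l′ ++ toList y))

  goR-corrections : ∀ n x rs y → (∀ rs′ → length rs′ ≡ length rs → GuinOudom n x rs′) → ∀ f → Symmetric f →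
    eval (concatMap (λ { (yᵢ , put) → bind (preLie yᵢ y) (λ m → goR n x (put m)) }) (replacements rs))
         (λ m → f (toList m))
      ≈ Σ (incAllL^ (length rs) (toList x)) (λ d → Σ (incAllL (flatten rs)) (λ e → f (d ++ (e ++ toList y))))
  goR-corrections n x rs y go f f-sym = begin
    eval (concatMap (λ { (yᵢ , put) → bind (preLie yᵢ y) (λ m → goR n x (put m)) }) (replacements rs)) f′
      ≈⟨ Σ-concatMap (replacements rs) _ _ ⟩
    Σ (replacements rs) (λ r → eval (bind (preLie (proj₁ r) y) (λ m → goR n x (proj₂ r m))) f′)
      ≈⟨ Σ-cong (replacements rs) (λ r → eval-bind (preLie (proj₁ r) y) (λ m → goR n x (proj₂ r m)) f′) ⟩
    Σ (replacements rs) (λ r → eval (preLie (proj₁ r) y) (λ m → eval (goR n x (proj₂ r m)) f′))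
      ≈⟨ Σ-cong (replacements rs) (λ r → Σ-map (incAll (proj₁ r)) _ _) ⟩
    Σ (replacements rs) (λ r → Σ (incAll (proj₁ r)) (λ M′ → 1# * eval (goR n x (proj₂ r (M′ ⁺++⁺ y))) f′))
      ≈⟨ Σ-cong-All (replacements rs) (All.map (λ {r} r↭ → Σ-cong (incAll (proj₁ r)) (λ M′ →
           trans (*-identityˡ _) (replaced r (M′ ⁺++⁺ y) (↭-length (r↭ (M′ ⁺++⁺ y))))))
           (replacements-↭ rs)) ⟩
    Σ (replacements rs) (λ r → Σ (incAll (proj₁ r)) (λ M′ → Σ Dᵏx (λ d → f (d ++ flatten (proj₂ r (M′ ⁺++⁺ y))))))
      ≈⟨ Σ-cong (replacements rs) (λ r → Σ-swap (incAll (proj₁ r)) Dᵏx _) ⟩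
    Σ (replacements rs) (λ r → Σ Dᵏx (λ d → Σ (incAll (proj₁ r)) (λ M′ → f (d ++ flatten (proj₂ r (M′ ⁺++⁺ y))))))
      ≈⟨ Σ-swap (replacements rs) Dᵏx _ ⟩
    Σ Dᵏx (λ d → Σ (replacements rs) (λ r → Σ (incAll (proj₁ r)) (λ M′ → f (d ++ flatten (proj₂ r (M′ ⁺++⁺ y))))))
      ≈⟨ Σ-cong Dᵏx (λ d → Σ-replacements rs y (λ l → f (d ++ l)) (λ p → f-sym (++⁺ˡ d p))) ⟩
    Σ Dᵏx (λ d → Σ (incAllL (flatten rs)) (λ e → f (d ++ (e ++ toList y)))) ∎
    where
    f′ : Mono → Carrier
    f′ m = f (toList m)
    Dᵏx = incAllL^ (length rs) (toList x)
    replaced : ∀ (r : Mono × (Mono → Word)) m → suc (length (proj₂ r m)) ≡ suc (length rs) →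
      eval (goR n x (proj₂ r m)) f′ ≈ Σ Dᵏx (λ d → f (d ++ flatten (proj₂ r m)))
    replaced r m len≡ = trans (go (proj₂ r m) (ℕP.suc-injective len≡) f f-sym)
      (reflexive (≡.cong (λ k → Σ (incAllL^ k (toList x)) _) (ℕP.suc-injective len≡)))

  goR-eval : ∀ n x rs → length rs ≤ n → GuinOudom n x rs
  goR-eval n x [] _ f f-sym =
    +-congʳ (trans (*-identityˡ _) (reflexive (≡.cong f (≡.sym (Listₚ.++-identityʳ (toList x))))))
  goR-eval (suc n) x (y ∷ rs) (ℕ.s≤s le) f f-sym = begin
    eval (preLieP (goR n x rs) y ++ neg corrections) f′
      ≈⟨ Σ-++ (preLieP (goR n x rs) y) (neg corrections) _ ⟩
    eval (preLieP (goR n x rs) y) f′ + eval (neg corrections) f′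
      ≈⟨ +-cong (goR-derived n x rs y (goR-eval n x rs le) f f-sym)
                (trans (eval-neg corrections f′)
                  (-‿cong (goR-corrections n x rs y (λ rs′ len≡ → goR-eval n x rs′ (≡.subst (_≤ n) (≡.sym len≡) le)) f f-sym))) ⟩
    (S₁ + S₂) + - S₂
      ≈⟨ trans (+-assoc _ _ _) (trans (+-congˡ (-‿inverseʳ S₂)) (+-identityʳ S₁)) ⟩
    S₁
      ≈⟨ Σ-cong Dᵏx (λ d → Σ-cong (incAllL d) (λ e → f-sym (++-swap-tails e (flatten rs) (toList y)))) ⟩
    Σ Dᵏx (λ d → Σ (incAllL d) (λ e → f (e ++ (toList y ++ flatten rs))))
      ≈⟨ sym (Σ-concatMap Dᵏx incAllL _) ⟩
    Σ (incAllL^ (suc (length rs)) (toList x)) (λ d → f (d ++ flatten (y ∷ rs))) ∎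
    where
    f′ : Mono → Carrier
    f′ m = f (toList m)
    Dᵏx = incAllL^ (length rs) (toList x)
    corrections = concatMap (λ { (yᵢ , put) → bind (preLie yᵢ y) (λ m → goR n x (put m)) }) (replacements rs)
    S₁ = Σ Dᵏx (λ d → Σ (incAllL d) (λ e → f ((e ++ flatten rs) ++ toList y)))
    S₂ = Σ Dᵏx (λ d → Σ (incAllL (flatten rs)) (λ e → f (d ++ (e ++ toList y))))
    ++-swap-tails : (xs ys zs : List ℕ) → (xs ++ ys) ++ zs ↭ xs ++ (zs ++ ys)
    ++-swap-tails xs ys zs = ↭-trans (↭-reflexive (Listₚ.++-assoc xs ys zs)) (++⁺ˡ xs (++-comm ys zs))

  actMono-eval : ∀ u V f → Symmetric f →
    eval (actMono u V) (λ m → f (toList m)) ≈ Σ (incAllL^ (length V) (toList u)) (λ d → f (d ++ flatten V))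
  actMono-eval u V f f-sym = begin
    eval (goR (length V) u (List.reverse V)) (λ m → f (toList m))
      ≈⟨ goR-eval (length V) u (List.reverse V) (ℕP.≤-reflexive (Listₚ.length-reverse V)) f f-sym ⟩
    Σ (incAllL^ (length (List.reverse V)) (toList u)) (λ d → f (d ++ flatten (List.reverse V)))
      ≡⟨ ≡.cong (λ k → Σ (incAllL^ k (toList u)) (λ d → f (d ++ flatten (List.reverse V)))) (Listₚ.length-reverse V) ⟩
    Σ (incAllL^ (length V) (toList u)) (λ d → f (d ++ flatten (List.reverse V)))
      ≈⟨ Σ-cong (incAllL^ (length V) (toList u)) (λ d → f-sym (++⁺ˡ d (flatten-↭ (↭-reverse V)))) ⟩
    Σ (incAllL^ (length V) (toList u)) (λ d → f (d ++ flatten V)) ∎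

  -- Pairing words

  pairMono≈matchings : ∀ m n → pairMono m n ≈ matchings (toList m) (toList n)
  pairMono≈matchings m n = sym (matchings≈pairIdx (toList m) (toList n))

  pairW-[-] : ∀ m n → pairW (m ∷ []) (n ∷ []) ≈ pairMono m n
  pairW-[-] m n = trans (+-identityʳ _) (*-identityʳ _)

  pairW-length : ∀ (ws vs : Word) → length ws ≢ length vs → pairW ws vs ≈ 0#
  pairW-length []       []      ne with () ← ne ≡.refl
  pairW-length []       (_ ∷ _) ne = refl
  pairW-length (w ∷ ws) vs      ne = Σ-zero-All (picks vs) (All.map (λ {p} e →
    trans (*-congˡ (pairW-length ws (proj₂ p) (λ e′ → ne (≡.trans (≡.cong suc e′) e)))) (zeroʳ _))
    (picks-length vs))

  matchings-[]-flatten : ∀ (V : Word) → length V ≢ 0 → matchings [] (flatten V) ≈ 0#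
  matchings-[]-flatten []                ne with () ← ne ≡.refl
  matchings-[]-flatten ((_ ∷ _) ∷ _) _ = refl

  Σ-properSplits : ∀ m (h : List ℕ → List ℕ → Carrier) → (∀ js → h [] js ≈ 0#) → (∀ is → h is [] ≈ 0#) →
    Σ (properSplits m) (λ p → h (toList (proj₁ p)) (toList (proj₂ p))) ≈ Σ (splits (toList m)) (λ st → h (proj₁ st) (proj₂ st))
  Σ-properSplits m h h₁ h₂ = trans (Σ-concatMap (splits (toList m)) _ _) (Σ-cong (splits (toList m))
    (λ { ([] , js) → sym (h₁ js) ; (i ∷ is , []) → sym (h₂ (i ∷ is)) ; (_ ∷ _ , _ ∷ _) → +-identityʳ _ }))

  invFact-! : ∀ k → invFact k * fromℕ (k !) ≈ 1#
  invFact-! zero    = trans (*-identityˡ _) (+-identityʳ _)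
  invFact-! (suc k) = begin
    (invFact k * k⁻¹) * fromℕ (suc k !)
      ≈⟨ *-congˡ (fromℕ-* (suc k) (k !)) ⟩
    (invFact k * k⁻¹) * (fromℕ (suc k) * fromℕ (k !))
      ≈⟨ trans (*-assoc _ _ _) (*-congˡ (sym (*-assoc _ _ _))) ⟩
    invFact k * ((k⁻¹ * fromℕ (suc k)) * fromℕ (k !))
      ≈⟨ *-congˡ (trans (*-congʳ (trans (*-comm _ _) (inverse (fromℕ (suc k)) (char0 k)))) (*-identityˡ _)) ⟩
    invFact k * fromℕ (k !)
      ≈⟨ invFact-! k ⟩
    1# ∎
    where
    k⁻¹ = (fromℕ (suc k) ⁻¹) (char0 k)

  Σ-redIter-pairW : ∀ k b (V : Word) → length V ≡ suc k →
    Σ (redIter k b) (λ t → pairW (toList t) V) ≈ fromℕ (suc k !) * matchings (toList b) (flatten V)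
  Σ-redIter-pairW zero b (v ∷ []) _ = begin
    pairW (b ∷ []) (v ∷ []) + 0#
      ≈⟨ trans (+-identityʳ _) (trans (pairW-[-] b v) (pairMono≈matchings b v)) ⟩
    matchings (toList b) (toList v)
      ≈⟨ sym (*-identityˡ _) ⟩
    1# * matchings (toList b) (toList v)
      ≈⟨ *-cong (sym (+-identityʳ 1#)) (reflexive (≡.cong (matchings (toList b)) (≡.sym (Listₚ.++-identityʳ (toList v))))) ⟩
    (1# + 0#) * matchings (toList b) (toList v ++ []) ∎
  Σ-redIter-pairW (suc k) b V len≡ = begin
    Σ (redIter (suc k) b) (λ t → pairW (toList t) V)
      ≈⟨ Σ-concatMap (properSplits b) _ _ ⟩
    Σ (properSplits b) (λ p → Σ (map (λ t → proj₁ p ∷ toList t) (redIter k (proj₂ p))) (λ t → pairW (toList t) V))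
      ≈⟨ Σ-cong (properSplits b) (λ p → Σ-map (redIter k (proj₂ p)) _ _) ⟩
    Σ (properSplits b) (λ p → Σ (redIter k (proj₂ p)) (λ t →
        Σ (picks V) (λ q → pairMono (proj₁ p) (proj₁ q) * pairW (toList t) (proj₂ q))))
      ≈⟨ Σ-cong (properSplits b) (λ p → trans (Σ-swap (redIter k (proj₂ p)) (picks V) _)
           (Σ-cong (picks V) (λ q → sym (Σ-*ˡ _ (redIter k (proj₂ p)) _)))) ⟩
    Σ (properSplits b) (λ p → Σ (picks V) (λ q →
        pairMono (proj₁ p) (proj₁ q) * Σ (redIter k (proj₂ p)) (λ t → pairW (toList t) (proj₂ q))))
      ≈⟨ Σ-swap (properSplits b) (picks V) _ ⟩
    Σ (picks V) (λ q → Σ (properSplits b) (λ p →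
        pairMono (proj₁ p) (proj₁ q) * Σ (redIter k (proj₂ p)) (λ t → pairW (toList t) (proj₂ q))))
      ≈⟨ Σ-cong-All (picks V) (All.map (λ {q} (q-len , V↭) → pick (proj₁ q) (proj₂ q) q-len V↭)
           (All.zip (picks-length V , picks-↭ V))) ⟩
    Σ (picks V) (λ _ → fromℕ (suc k !) * matchings (toList b) (flatten V))
      ≈⟨ Σ-const (picks V) _ ⟩
    fromℕ (length (picks V)) * (fromℕ (suc k !) * matchings (toList b) (flatten V))
      ≡⟨ ≡.cong (λ n → fromℕ n * (fromℕ (suc k !) * matchings (toList b) (flatten V)))
                (≡.trans (length-picks V) len≡) ⟩
    fromℕ (suc (suc k)) * (fromℕ (suc k !) * matchings (toList b) (flatten V))
      ≈⟨ trans (sym (*-assoc _ _ _)) (*-congʳ (sym (fromℕ-* (suc (suc k)) (suc k !)))) ⟩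
    fromℕ (suc (suc k) !) * matchings (toList b) (flatten V) ∎
    where
    open import Algebra.Properties.CommutativeSemigroup *-commutativeSemigroup using (x∙yz≈y∙xz)
    k! = fromℕ (suc k !)
    pick : ∀ q r → suc (length r) ≡ length V → V ↭ q ∷ r →
      Σ (properSplits b) (λ p → pairMono (proj₁ p) q * Σ (redIter k (proj₂ p)) (λ t → pairW (toList t) r))
        ≈ k! * matchings (toList b) (flatten V)
    pick q r r-len V↭ = begin
      Σ (properSplits b) (λ p → pairMono (proj₁ p) q * Σ (redIter k (proj₂ p)) (λ t → pairW (toList t) r))
        ≈⟨ Σ-cong (properSplits b) (λ p → *-cong (pairMono≈matchings (proj₁ p) q) (Σ-redIter-pairW k (proj₂ p) r len-r)) ⟩
      Σ (properSplits b) (λ p → matchings (toList (proj₁ p)) (toList q) * (k! * matchings (toList (proj₂ p)) (flatten r)))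
        ≈⟨ Σ-cong (properSplits b) (λ _ → x∙yz≈y∙xz _ _ _) ⟩
      Σ (properSplits b) (λ p → k! * (matchings (toList (proj₁ p)) (toList q) * matchings (toList (proj₂ p)) (flatten r)))
        ≈⟨ sym (Σ-*ˡ k! (properSplits b) _) ⟩
      k! * Σ (properSplits b) (λ p → matchings (toList (proj₁ p)) (toList q) * matchings (toList (proj₂ p)) (flatten r))
        ≈⟨ *-congˡ (Σ-properSplits b (λ is js → matchings is (toList q) * matchings js (flatten r))
             (λ _ → zeroˡ _)
             (λ _ → trans (*-congˡ (matchings-[]-flatten r λ e → ℕP.0≢1+n (≡.trans (≡.sym e) len-r))) (zeroʳ _))) ⟩
      k! * Σ (splits (toList b)) (λ st → matchings (proj₁ st) (toList q) * matchings (proj₂ st) (flatten r))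
        ≈⟨ *-congˡ (sym (matchings-++ (toList b) (toList q) (flatten r))) ⟩
      k! * matchings (toList b) (toList q ++ flatten r)
        ≈⟨ *-congˡ (matchings-↭ʳ (toList b) (flatten-↭ (↭-sym V↭))) ⟩
      k! * matchings (toList b) (flatten V) ∎
      where
      len-r : length r ≡ suc k
      len-r = ℕP.suc-injective (≡.trans r-len len≡)

  Σ-decAll : ∀ M (g : List ℕ → Carrier) → Σ (decAll M) (λ M′ → g (toList M′)) ≈ Σ (decAllL (toList M)) g
  Σ-decAll M g = trans (sym (Σ-map (decAll M) toList g)) (reflexive (≡.cong (λ l → Σ l g) (toList-decAll M)))

  D′^-adjoint : ∀ k (p : Poly) js →
    eval (D'^ k p) (λ m → matchings (toList m) js) ≈ eval p (λ m → Σ (incAllL^′ k js) (matchings (toList m)))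
  D′^-adjoint zero    p js = Σ-cong p (λ _ → *-congˡ (sym (+-identityʳ _)))
  D′^-adjoint (suc k) p js = begin
    eval (D' (D'^ k p)) (λ m → matchings (toList m) js)
      ≈⟨ eval-bind (D'^ k p) _ _ ⟩
    eval (D'^ k p) (λ m → eval (map (λ m′ → (1# , m′)) (decAll m)) (λ m′ → matchings (toList m′) js))
      ≈⟨ Σ-cong (D'^ k p) (λ q → *-congˡ (trans (Σ-map (decAll (proj₂ q)) _ _)
           (trans (Σ-cong (decAll (proj₂ q)) (λ _ → *-identityˡ _))
             (trans (Σ-decAll (proj₂ q) (λ is → matchings is js)) (decAllL-adjoint (toList (proj₂ q)) js))))) ⟩
    eval (D'^ k p) (λ m → Σ (incAllL js) (matchings (toList m)))
      ≈⟨ eval-Σ (D'^ k p) (incAllL js) (λ m → matchings (toList m)) ⟩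
    Σ (incAllL js) (λ js′ → eval (D'^ k p) (λ m → matchings (toList m) js′))
      ≈⟨ Σ-cong (incAllL js) (D′^-adjoint k p) ⟩
    Σ (incAllL js) (λ js′ → eval p (λ m → Σ (incAllL^′ k js′) (matchings (toList m))))
      ≈⟨ sym (eval-Σ p (incAllL js) (λ m js′ → Σ (incAllL^′ k js′) (matchings (toList m)))) ⟩
    eval p (λ m → Σ (incAllL js) (λ js′ → Σ (incAllL^′ k js′) (matchings (toList m))))
      ≈⟨ Σ-cong p (λ _ → *-congˡ (sym (Σ-concatMap (incAllL js) (incAllL^′ k) _))) ⟩
    eval p (λ m → Σ (incAllL^′ (suc k) js) (matchings (toList m))) ∎

  Σ-incAllL-incAllL^ : ∀ k js (h : List ℕ → Carrier) →
    Σ (incAllL js) (λ js′ → Σ (incAllL^ k js′) h) ≈ Σ (incAllL^ k js) (λ js′ → Σ (incAllL js′) h)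
  Σ-incAllL-incAllL^ zero    js h = trans (Σ-cong (incAllL js) (λ _ → +-identityʳ _)) (sym (+-identityʳ _))
  Σ-incAllL-incAllL^ (suc k) js h = begin
    Σ (incAllL js) (λ js′ → Σ (concatMap incAllL (incAllL^ k js′)) h)
      ≈⟨ Σ-cong (incAllL js) (λ js′ → Σ-concatMap (incAllL^ k js′) incAllL h) ⟩
    Σ (incAllL js) (λ js′ → Σ (incAllL^ k js′) (λ e → Σ (incAllL e) h))
      ≈⟨ Σ-incAllL-incAllL^ k js (λ e → Σ (incAllL e) h) ⟩
    Σ (incAllL^ k js) (λ e → Σ (incAllL e) (λ e′ → Σ (incAllL e′) h))
      ≈⟨ sym (Σ-concatMap (incAllL^ k js) incAllL _) ⟩
    Σ (incAllL^ (suc k) js) (λ e → Σ (incAllL e) h) ∎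

  Σ-incAllL^′ : ∀ k js (h : List ℕ → Carrier) → Σ (incAllL^′ k js) h ≈ Σ (incAllL^ k js) h
  Σ-incAllL^′ zero    js h = refl
  Σ-incAllL^′ (suc k) js h = begin
    Σ (concatMap (incAllL^′ k) (incAllL js)) h
      ≈⟨ Σ-concatMap (incAllL js) (incAllL^′ k) h ⟩
    Σ (incAllL js) (λ js′ → Σ (incAllL^′ k js′) h)
      ≈⟨ Σ-cong (incAllL js) (λ js′ → Σ-incAllL^′ k js′ h) ⟩
    Σ (incAllL js) (λ js′ → Σ (incAllL^ k js′) h)
      ≈⟨ Σ-incAllL-incAllL^ k js h ⟩
    Σ (incAllL^ k js) (λ js′ → Σ (incAllL js′) h)
      ≈⟨ sym (Σ-concatMap (incAllL^ k js) incAllL h) ⟩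
    Σ (incAllL^ (suc k) js) h ∎

  D′^-pairing : ∀ k a u →
    Σ (D'^ k ((1# , a) ∷ [])) (λ p → (invFact k * proj₁ p) * pairW (proj₂ p ∷ []) (u ∷ []))
      ≈ invFact k * Σ (incAllL^ k (toList u)) (matchings (toList a))
  D′^-pairing k a u = begin
    Σ (D'^ k ((1# , a) ∷ [])) (λ p → (invFact k * proj₁ p) * pairW (proj₂ p ∷ []) (u ∷ []))
      ≈⟨ Σ-cong (D'^ k ((1# , a) ∷ [])) (λ p → trans (*-assoc _ _ _)
           (*-congˡ (*-congˡ (trans (pairW-[-] (proj₂ p) u) (pairMono≈matchings (proj₂ p) u))))) ⟩
    Σ (D'^ k ((1# , a) ∷ [])) (λ p → invFact k * (proj₁ p * matchings (toList (proj₂ p)) (toList u)))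
      ≈⟨ sym (Σ-*ˡ _ (D'^ k ((1# , a) ∷ [])) _) ⟩
    invFact k * eval (D'^ k ((1# , a) ∷ [])) (λ m → matchings (toList m) (toList u))
      ≈⟨ *-congˡ (D′^-adjoint k ((1# , a) ∷ []) (toList u)) ⟩
    invFact k * (1# * Σ (incAllL^′ k (toList u)) (matchings (toList a)) + 0#)
      ≈⟨ *-congˡ (trans (+-identityʳ _) (trans (*-identityˡ _) (Σ-incAllL^′ k (toList u) _))) ⟩
    invFact k * Σ (incAllL^ k (toList u)) (matchings (toList a)) ∎

  -- ⟨(1/k!) (D′ᵏ ⊗ |⁽ᵏ⁻¹⁾) Δ̃⁽ᵏ⁾ m , U ⊗ V⟩
  termPairing : Word → Word → ℕ → Mono → Carrier
  termPairing U V k m = Σ (redIter k m) (λ t → Σ (D'^ k ((1# , List⁺.head t) ∷ []))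
    (λ p → ((invFact k * proj₁ p) * pairW (proj₂ p ∷ []) U) * pairW (List⁺.tail t) V))

  termPairing-properSplits : ∀ U V j m → termPairing U V (suc j) m ≈ Σ (properSplits m) (λ q →
      Σ (D'^ (suc j) ((1# , proj₁ q) ∷ [])) (λ p → (invFact (suc j) * proj₁ p) * pairW (proj₂ p ∷ []) U)
    * Σ (redIter j (proj₂ q)) (λ t → pairW (toList t) V))
  termPairing-properSplits U V j m = trans (Σ-concatMap (properSplits m) _ _)
    (Σ-cong (properSplits m) (λ q → trans (Σ-map (redIter j (proj₂ q)) _ _)
      (trans (Σ-cong (redIter j (proj₂ q)) (λ _ → sym (Σ-*ʳ _ (D'^ (suc j) ((1# , proj₁ q) ∷ [])) _)))
        (sym (Σ-*ˡ _ (redIter j (proj₂ q)) _)))))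

  termPairing-zeroˡ : ∀ U V k m → (∀ m′ → pairW (m′ ∷ []) U ≈ 0#) → termPairing U V k m ≈ 0#
  termPairing-zeroˡ U V k m h = Σ-zero (redIter k m) (λ _ → Σ-zero (D'^ k _) (λ p →
    trans (*-congʳ (trans (*-congˡ (h (proj₂ p))) (zeroʳ _))) (zeroˡ _)))

  termPairing-zeroʳ : ∀ U V k m → length V ≢ k → termPairing U V k m ≈ 0#
  termPairing-zeroʳ U V k m ne = Σ-zero-All (redIter k m) (All.map (λ {t} e → Σ-zero (D'^ k _) (λ _ →
    trans (*-congˡ (pairW-length (List⁺.tail t) V (λ e′ → ne (≡.trans (≡.sym e′) e)))) (zeroʳ _)))
    (redIter-tail-length k m))

  termPairing-[u] : ∀ j m u (V : Word) → length V ≡ suc j →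
    termPairing (u ∷ []) V (suc j) m ≈ eval (actMono u V) (pairMono m)
  termPairing-[u] j m u V len≡ = begin
    termPairing (u ∷ []) V (suc j) m
      ≈⟨ termPairing-properSplits (u ∷ []) V j m ⟩
    Σ (properSplits m) (λ q →
        Σ (D'^ (suc j) ((1# , proj₁ q) ∷ [])) (λ p → (invFact (suc j) * proj₁ p) * pairW (proj₂ p ∷ []) (u ∷ []))
      * Σ (redIter j (proj₂ q)) (λ t → pairW (toList t) V))
      ≈⟨ Σ-cong (properSplits m) (λ q → *-cong (D′^-pairing (suc j) (proj₁ q) u) (Σ-redIter-pairW j (proj₂ q) V len≡)) ⟩
    Σ (properSplits m) (λ q → (invFact (suc j) * Dᵏu-pairing (proj₁ q))
                              * (fromℕ (suc j !) * matchings (toList (proj₂ q)) (flatten V)))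
      ≈⟨ Σ-cong (properSplits m) (λ _ → trans (interchange* _ _ _ _)
           (trans (*-congʳ (invFact-! (suc j))) (*-identityˡ _))) ⟩
    Σ (properSplits m) (λ q → Dᵏu-pairing (proj₁ q) * matchings (toList (proj₂ q)) (flatten V))
      ≈⟨ Σ-cong (properSplits m) (λ q → Σ-*ʳ _ Dᵏu _) ⟩
    Σ (properSplits m) (λ q → Σ Dᵏu (λ d → matchings (toList (proj₁ q)) d * matchings (toList (proj₂ q)) (flatten V)))
      ≈⟨ Σ-swap (properSplits m) Dᵏu _ ⟩
    Σ Dᵏu (λ d → Σ (properSplits m) (λ q → matchings (toList (proj₁ q)) d * matchings (toList (proj₂ q)) (flatten V)))
      ≈⟨ Σ-cong-All Dᵏu (All.map (λ {d} d-len → Σ-properSplits m (λ is js → matchings is d * matchings js (flatten V))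
           (λ _ → trans (*-congʳ (matchings-[]-nonempty d d-len)) (zeroˡ _))
           (λ _ → trans (*-congˡ (matchings-[]-flatten V λ e → ℕP.0≢1+n (≡.trans (≡.sym e) len≡))) (zeroʳ _)))
           (incAllL^-length (suc j) (toList u))) ⟩
    Σ Dᵏu (λ d → Σ (splits (toList m)) (λ st → matchings (proj₁ st) d * matchings (proj₂ st) (flatten V)))
      ≈⟨ Σ-cong Dᵏu (λ d → sym (matchings-++ (toList m) d (flatten V))) ⟩
    Σ Dᵏu (λ d → matchings (toList m) (d ++ flatten V))
      ≡⟨ ≡.cong (λ k → Σ (incAllL^ k (toList u)) (λ d → matchings (toList m) (d ++ flatten V))) (≡.sym len≡) ⟩
    Σ (incAllL^ (length V) (toList u)) (λ d → matchings (toList m) (d ++ flatten V))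
      ≈⟨ sym (actMono-eval u V (matchings (toList m)) (matchings-↭ʳ (toList m))) ⟩
    eval (actMono u V) (λ n → matchings (toList m) (toList n))
      ≈⟨ Σ-cong (actMono u V) (λ p → *-congˡ (sym (pairMono≈matchings m (proj₂ p)))) ⟩
    eval (actMono u V) (pairMono m) ∎
    where
    open import Algebra.Properties.CommutativeSemigroup *-commutativeSemigroup
      using () renaming (interchange to interchange*)
    Dᵏu = incAllL^ (suc j) (toList u)
    Dᵏu-pairing : Mono → Carrier
    Dᵏu-pairing a = Σ Dᵏu (matchings (toList a))
    matchings-[]-nonempty : ∀ d → length d ≡ length (toList u) → matchings [] d ≈ 0#
    matchings-[]-nonempty (_ ∷ _) _ = refl

  -- Pairing with the Grossman–Larson product

  act-length : ∀ U w → AllTerms (λ W → length W ≡ length U) (act U w)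
  act-length []       []      = ≡.refl ∷ []
  act-length []       (_ ∷ _) = []
  act-length (u ∷ us) w = concatMap⁺ (All.universal (λ st →
    bar-length (map (λ { (a , m) → (a , m ∷ []) }) (actMono u (proj₁ st))) (act us (proj₂ st))
      (AllP.map⁺ (All.universal (λ _ → ≡.refl) (actMono u (proj₁ st)))) (act-length us (proj₂ st))) (splits w))
    where
    bar-length : ∀ (X Y : SElem) → AllTerms (λ W → length W ≡ 1) X → AllTerms (λ W → length W ≡ length us) Y →
                 AllTerms (λ W → length W ≡ suc (length us)) (bar X Y)
    bar-length []            Y []         hy = []
    bar-length ((a , x) ∷ X) Y (x≡ ∷ hx) hy = AllP.++⁺
      (AllP.map⁺ (AllP.map⁺ (All.map (λ e → ≡.trans (Listₚ.length-++ x) (≡.cong₂ ℕ._+_ x≡ e)) hy)))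
      (bar-length X Y hx hy)

  eval-gl : ∀ U V (g : Word → Carrier) →
    eval (gl U V) g ≈ Σ (splits V) (λ st → Σ (act U (proj₂ st)) (λ p → proj₁ p * g (proj₁ st ++ proj₂ p)))
  eval-gl U V g = trans (Σ-concatMap (splits V) _ _) (Σ-cong (splits V) (λ st → Σ-map (act U (proj₂ st)) _ _))

  gl-[]-pairing : ∀ m V → eval (gl [] V) (pairW (m ∷ [])) ≈ pairW (m ∷ []) V
  gl-[]-pairing m V = begin
    eval (gl [] V) (pairW (m ∷ []))
      ≈⟨ eval-gl [] V _ ⟩
    Σ (splits V) (λ st → Σ (act [] (proj₂ st)) (λ p → proj₁ p * pairW (m ∷ []) (proj₁ st ++ proj₂ p)))
      ≈⟨ Σ-splits-left V _ (λ _ _ _ → refl) ⟩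
    1# * pairW (m ∷ []) (V ++ []) + 0#
      ≈⟨ trans (+-identityʳ _) (trans (*-identityˡ _) (reflexive (≡.cong (pairW (m ∷ [])) (Listₚ.++-identityʳ V)))) ⟩
    pairW (m ∷ []) V ∎

  gl-[u]-pairing : ∀ m u V → eval (gl (u ∷ []) V) (pairW (m ∷ [])) ≈ eval (actMono u V) (pairMono m)
  gl-[u]-pairing m u V = begin
    eval (gl (u ∷ []) V) (pairW (m ∷ []))
      ≈⟨ eval-gl (u ∷ []) V _ ⟩
    Σ (splits V) (λ st → Σ (act (u ∷ []) (proj₂ st)) (λ p → proj₁ p * pairW (m ∷ []) (proj₁ st ++ proj₂ p)))
      ≈⟨ Σ-splits-right V _ (λ y ys t → Σ-zero-All (act (u ∷ []) t) (All.map (λ {p} e →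
           trans (*-congˡ (pairW-length (m ∷ []) (y ∷ ys ++ proj₂ p) (too-long {y} ys (proj₂ p) e))) (zeroʳ _))
           (act-length (u ∷ []) t))) ⟩
    Σ (act (u ∷ []) V) (λ p → proj₁ p * pairW (m ∷ []) (proj₂ p))
      ≈⟨ Σ-concatMap (splits V) _ _ ⟩
    Σ (splits V) (λ st → Σ (bar (map _ (actMono u (proj₁ st))) (act [] (proj₂ st))) _)
      ≈⟨ Σ-splits-left V _ (λ s _ _ → trans (Σ-concatMap (map _ (actMono u s)) _ _) (Σ-0 (map _ (actMono u s)))) ⟩
    Σ (bar (map _ (actMono u V)) ((1# , []) ∷ [])) (λ p → proj₁ p * pairW (m ∷ []) (proj₂ p))
      ≈⟨ trans (Σ-concatMap (map _ (actMono u V)) _ _) (Σ-map (actMono u V) _ _) ⟩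
    Σ (actMono u V) (λ q → (proj₁ q * 1#) * pairW (m ∷ []) (proj₂ q ∷ []) + 0#)
      ≈⟨ Σ-cong (actMono u V) (λ q → trans (+-identityʳ _) (*-cong (*-identityʳ _) (pairW-[-] m (proj₂ q)))) ⟩
    eval (actMono u V) (pairMono m) ∎
    where
    too-long : ∀ {y} (ys w : Word) → length w ≡ 1 → 1 ≢ length (y ∷ ys ++ w)
    too-long ys w w≡ e = ℕP.1+n≢0 (≡.sym (ℕP.suc-injective (≡.trans e (≡.cong suc
      (≡.trans (Listₚ.length-++ ys) (≡.trans (≡.cong (length ys ℕ.+_) w≡) (ℕP.+-comm (length ys) 1)))))))

  rhsPairing : Word → Word → ℕ → Mono → Carrier
  rhsPairing U V N m = pairW (m ∷ []) U * pairW [] V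
                     + (pairW [] U * pairW (m ∷ []) V + Σ₁ N (λ k → termPairing U V k m))

  rhsPairing-[] : ∀ N m V → rhsPairing [] V N m ≈ pairW (m ∷ []) V
  rhsPairing-[] N m V = trans (+-cong (zeroˡ _) (+-cong (*-identityˡ _)
      (Σ₁-zero N (λ k → termPairing-zeroˡ [] V (suc k) m (λ _ → refl)))))
    (trans (+-identityˡ _) (+-identityʳ _))

  rhsPairing-[u] : ∀ N m u V → lenM m ≤ N → rhsPairing (u ∷ []) V N m ≈ eval (actMono u V) (pairMono m)
  rhsPairing-[u] N m u [] _ = begin
    pairW (m ∷ []) (u ∷ []) * 1# + (0# * pairW (m ∷ []) [] + Σ₁ N (λ k → termPairing (u ∷ []) [] k m))
      ≈⟨ +-cong (*-identityʳ _) (trans (+-cong (zeroˡ _)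
           (Σ₁-zero N (λ k → termPairing-zeroʳ (u ∷ []) [] (suc k) m λ ()))) (+-identityʳ _)) ⟩
    pairW (m ∷ []) (u ∷ []) + 0#
      ≈⟨ trans (+-identityʳ _) (trans (pairW-[-] m u) (sym (trans (+-identityʳ _) (*-identityˡ _)))) ⟩
    eval (actMono u []) (pairMono m) ∎
  rhsPairing-[u] N m u V@(_ ∷ vs) m≤N = begin
    pairW (m ∷ []) (u ∷ []) * 0# + (0# * pairW (m ∷ []) V + Σ₁ N (λ k → termPairing (u ∷ []) V k m))
      ≈⟨ trans (+-cong (zeroʳ _) (trans (+-congʳ (zeroˡ _)) (+-identityˡ _))) (+-identityˡ _) ⟩
    Σ₁ N (λ k → termPairing (u ∷ []) V k m)
      ≈⟨ only-|V| ⟩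
    termPairing (u ∷ []) V (length V) m
      ≈⟨ termPairing-[u] (length vs) m u V ≡.refl ⟩
    eval (actMono u V) (pairMono m) ∎
    where
    others-vanish : ∀ k → k ≢ length V → termPairing (u ∷ []) V k m ≈ 0#
    others-vanish k ne = termPairing-zeroʳ (u ∷ []) V k m (λ e → ne (≡.sym e))
    only-|V| : Σ₁ N (λ k → termPairing (u ∷ []) V k m) ≈ termPairing (u ∷ []) V (length V) m
    only-|V| with length V ℕP.≤? N
    ... | yes |V|≤N = Σ₁-single N (length V) (ℕ.s≤s ℕ.z≤n) others-vanish |V|≤N
    ... | no  |V|≰N = trans (Σ₁-below N (length V) others-vanish (ℕP.≰⇒> |V|≰N))
      (sym (reflexive (≡.cong (λ ts → Σ ts _) (redIter-empty (length V) m
        (ℕP.≤-trans m≤N (ℕP.<⇒≤ (ℕP.≰⇒> |V|≰N)))))))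

  rhsPairing≈gl : ∀ N m U V → lenM m ≤ N → rhsPairing U V N m ≈ eval (gl U V) (pairW (m ∷ []))
  rhsPairing≈gl N m []          V _   = trans (rhsPairing-[] N m V) (sym (gl-[]-pairing m V))
  rhsPairing≈gl N m (u ∷ [])    V m≤N = trans (rhsPairing-[u] N m u V m≤N) (sym (gl-[u]-pairing m u V))
  rhsPairing≈gl N m U@(_ ∷ _ ∷ us) V _ = begin
    rhsPairing U V N m
      ≈⟨ +-cong (trans (*-congʳ (pairW-length (m ∷ []) U (too-long 0))) (zeroˡ _))
                (trans (+-cong (zeroˡ _) (Σ₁-zero N (λ k → termPairing-zeroˡ U V (suc k) m
                  (λ m′ → pairW-length (m′ ∷ []) U (too-long 0))))) (+-identityʳ _)) ⟩
    0# + 0#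
      ≈⟨ trans (+-identityʳ _) (sym (Σ-0 (splits V))) ⟩
    Σ (splits V) (λ _ → 0#)
      ≈⟨ sym (Σ-cong (splits V) (λ st → Σ-zero-All (act U (proj₂ st)) (All.map (λ {p} e →
           trans (*-congˡ (pairW-length (m ∷ []) (proj₁ st ++ proj₂ p) (λ e′ → too-long (length (proj₁ st))
             (≡.trans e′ (≡.trans (Listₚ.length-++ (proj₁ st)) (≡.cong (length (proj₁ st) ℕ.+_) e))))))
             (zeroʳ _))
           (act-length U (proj₂ st))))) ⟩
    Σ (splits V) (λ st → Σ (act U (proj₂ st)) (λ p → proj₁ p * pairW (m ∷ []) (proj₁ st ++ proj₂ p)))
      ≈⟨ sym (eval-gl U V _) ⟩
    eval (gl U V) (pairW (m ∷ [])) ∎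
    where
    too-long : ∀ n → 1 ≢ n ℕ.+ suc (suc (length us))
    too-long n e with () ← ℕP.suc-injective (≡.trans e (≡.trans (ℕP.+-suc n (suc (length us)))
                                                        (≡.cong suc (ℕP.+-suc n (length us)))))

  pairTerm : Word → Word → Carrier × (Word × Word) → Carrier
  pairTerm U V (a , (w₁ , w₂)) = a * pairW w₁ U * pairW w₂ V

  pairTerm-scale : ∀ U V a (T : STensor) → Σ (scale a T) (pairTerm U V) ≈ a * Σ T (pairTerm U V)
  pairTerm-scale U V a T = trans (Σ-map T _ _)
    (trans (Σ-cong T (λ _ → trans (*-assoc _ _ _) (trans (*-assoc _ _ _) (*-congˡ (sym (*-assoc _ _ _))))))
      (sym (Σ-*ˡ a T _)))

  pairTerm-bind : ∀ U V (P : Poly) (g : Mono → STensor) →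
    Σ (bind P g) (pairTerm U V) ≈ eval P (λ m → Σ (g m) (pairTerm U V))
  pairTerm-bind U V P g = trans (Σ-concatMap P _ _) (Σ-cong P (λ q → pairTerm-scale U V (proj₁ q) (g (proj₂ q))))

  term-pairing : ∀ U V k (P : Poly) → Σ (term k P) (pairTerm U V) ≈ eval P (termPairing U V k)
  term-pairing U V k P = trans (pairTerm-bind U V P _) (Σ-cong P (λ q → *-congˡ
    (trans (Σ-concatMap (redIter k (proj₂ q)) _ _) (Σ-cong (redIter k (proj₂ q)) (λ _ → Σ-map (D'^ k _) _ _)))))

  sumTerms-pairing : ∀ U V N (P : Poly) →
    Σ (sumTerms N P) (pairTerm U V) ≈ eval P (λ m → Σ₁ N (λ k → termPairing U V k m))
  sumTerms-pairing U V zero    P = sym (Σ-zero P (λ _ → zeroʳ _))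
  sumTerms-pairing U V (suc N) P = begin
    Σ (sumTerms N P ++ term (suc N) P) (pairTerm U V)
      ≈⟨ Σ-++ (sumTerms N P) (term (suc N) P) _ ⟩
    Σ (sumTerms N P) (pairTerm U V) + Σ (term (suc N) P) (pairTerm U V)
      ≈⟨ +-cong (sumTerms-pairing U V N P) (term-pairing U V (suc N) P) ⟩
    eval P (λ m → Σ₁ N (λ k → termPairing U V k m)) + eval P (λ m → termPairing U V (suc N) m)
      ≈⟨ trans (sym (Σ-+ P _ _)) (Σ-cong P (λ _ → sym (distribˡ _ _ _))) ⟩
    eval P (λ m → Σ₁ (suc N) (λ k → termPairing U V k m)) ∎

  lenM≤bound : ∀ (P : Poly) → All (λ q → lenM (proj₂ q) ≤ bound P) P
  lenM≤bound []            = []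
  lenM≤bound ((a , m) ∷ P) = ℕP.m≤m+n (lenM m) (bound P)
    ∷ All.map (λ le → ℕP.≤-trans le (ℕP.m≤n+m (bound P) (lenM m))) (lenM≤bound P)

  pairT-rhs : ∀ (P : Poly) (U V : Word) → pairT (rhs P) U V ≈ ΔNMI (embed P) U V
  pairT-rhs P U V = begin
    Σ (P⊗1 ++ (1⊗P ++ sumTerms (bound P) P)) (pairTerm U V)
      ≈⟨ trans (Σ-++ P⊗1 _ _) (+-congˡ (Σ-++ 1⊗P _ _)) ⟩
    Σ P⊗1 (pairTerm U V) + (Σ 1⊗P (pairTerm U V) + Σ (sumTerms (bound P) P) (pairTerm U V))
      ≈⟨ +-cong (trans (Σ-map P _ _) (Σ-cong P (λ _ → *-assoc _ _ _)))
           (+-cong (trans (Σ-map P _ _) (Σ-cong P (λ _ → *-assoc _ _ _))) (sumTerms-pairing U V (bound P) P)) ⟩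
    eval P (λ m → pairW (m ∷ []) U * pairW [] V) + (eval P (λ m → pairW [] U * pairW (m ∷ []) V)
      + eval P (λ m → Σ₁ (bound P) (λ k → termPairing U V k m)))
      ≈⟨ trans (+-congˡ (sym (Σ-+ P _ _))) (sym (Σ-+ P _ _)) ⟩
    Σ P (λ q → proj₁ q * (pairW (proj₂ q ∷ []) U * pairW [] V)
             + (proj₁ q * (pairW [] U * pairW (proj₂ q ∷ []) V) + proj₁ q * Σ₁ (bound P) (λ k → termPairing U V k (proj₂ q))))
      ≈⟨ Σ-cong P (λ _ → trans (+-congˡ (sym (distribˡ _ _ _))) (sym (distribˡ _ _ _))) ⟩
    eval P (rhsPairing U V (bound P))
      ≈⟨ Σ-cong-All P (All.map (λ m≤ → *-congˡ (rhsPairing≈gl (bound P) _ U V m≤)) (lenM≤bound P)) ⟩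
    eval P (λ m → eval (gl U V) (pairW (m ∷ [])))
      ≈⟨ Σ-cong P (λ _ → trans (Σ-*ˡ _ (gl U V) _) (Σ-cong (gl U V) (λ _ → sym (*-assoc _ _ _)))) ⟩
    Σ P (λ q → Σ (gl U V) (λ r → proj₁ q * proj₁ r * pairW (proj₂ q ∷ []) (proj₂ r)))
      ≈⟨ sym (trans (foldr-+-concatMap (embed P) _) (Σ-map P _ _)) ⟩
    ΔNMI (embed P) U V ∎
    where
    P⊗1 = map (λ { (a , m) → (a , (m ∷ [] , [])) }) P
    1⊗P = map (λ { (a , m) → (a , ([] , m ∷ [])) }) P

proposition3p14 : ∀ {c ℓ} (F : CharZeroField c ℓ) →
    let open CharZeroField F
        open WithField F
    in  (∀ (P : Poly) (U V : Word) → pairT (rhs P) U V ≈ ΔNMI (embed P) U V)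
      × (∀ (A U V : Word) → lenW U +ℕ lenW V ≢ lenW A → ΔNMI ((1# , A) ∷ []) U V ≈ 0#)
      × (∀ (A U V : Word) → degW U +ℤ degW V ≢ degW A → ΔNMI ((1# , A) ∷ []) U V ≈ 0#)
proposition3p14 F = pairT-rhs F , ΔNMI-homogeneous-length F , ΔNMI-homogeneous-degree F
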